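{- Let $k\ge 7$ be an integer, and let $G'_k(p,q)$ and $G'_k$ be the graphs defined below. Then: (1) in every proper $k$-edge-coloring of $G'_k(p,q)$, the edges $pp'$ and $qq'$ receive the same color; (2) for every $\alpha\in\{1,\dots,k\}$, there exists a $(pp',\alpha)$-connected greedy edge-coloring of $G'_k(p,q)$. Furthermore, $G'_k$ is a triangle-free graph with chromatic index $k$, and (3) $G'_k$ has a $(wt,\alpha)$-connected greedy edge-coloring with $k$ colors if and only if $\alpha\le k-3$.
   Context: $G'_k(p,q)$ is obtained from a complete bipartite graph $K_{k-1,k-1}$ with parts $P$ and $Q$ by adding vertices $p,q,p',q'$, making $p'$ adjacent to all of $P$, $q'$ adjacent to all of $Q$, and adding the edges $pp'$ and $qq'$. The graph $G'_k$ is obtained as follows: take $k$ disjoint copies of this graph, denoted $G'_k(p,q)$ and $G'_k(p_i,q_i)$ for $i\in\{1,\dots,k-1\}$ (with corresponding vertices $p_i,q_i,p'_i,q'_i$ in the $i$-th copy); identify the vertices $p_1,\dots,p_{k-1}$ into a single vertex $w$; identify $q,q_1,q_2,q_3$ into a single vertex $u$; identify $p,q_4,\dots,q_{k-1}$ into a single vertex $v$; finally add a new vertex $t$ adjacent to $w$. A connected ordering of the edges is an ordering $(e_1,\dots,e_m)$ of $E(G)$ in which each $e_i$, $i\ge 2$, shares an endpoint with some $e_j$, $j<i$. For an edge $e$ and positive integer $\alpha$, an $(e,\alpha)$-connected greedy edge-coloring is an edge-coloring obtained from some connected edge ordering starting with $e$ by coloring $e$ with $\alpha$ and then coloring each subsequent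 edge with the smallest positive integer not used on already-coloured edges sharing an endpoint with it (equivalently, an $(e,\alpha)$-connected greedy coloring of the line graph). -}

module Defs where

open import Data.Nat using (ℕ; zero; suc; _≤_; _<_; _∸_)
open import Data.Fin as Fin using (Fin; toℕ)
open import Data.List using (List; []; _∷_; map; concatMap; _++_; length; lookup; allFin)
open import Data.Product using (Σ; ∃; ∃-syntax; _×_; _,_; proj₁; proj₂)
open import Data.Sum using (_⊎_)
open import Data.Empty using (⊥)
open import Relation.Nullary using (¬_)
open import Relation.Binary.PropositionalEquality using (_≡_)
open import Function.Bundles using (_↔_; Inverse)

-- Finite (simple) graphs given by a vertex type and a list of edges.
-- Edges are referred to by their index  Fin (length E)  in the list.

record Graph : Set₁ where
  field
    V : Set
    E : List (V × V)

open Graph public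

∣E∣ : Graph → ℕ
∣E∣ G = length (E G)

EdgeIx : Graph → Set
EdgeIx G = Fin (∣E∣ G)

ends : (G : Graph) → EdgeIx G → V G × V G
ends G e = lookup (E G) e

Share : (G : Graph) → EdgeIx G → EdgeIx G → Set
Share G a b =
  (proj₁ (ends G a) ≡ proj₁ (ends G b)) ⊎ (proj₁ (ends G a) ≡ proj₂ (ends G b)) ⊎
  (proj₂ (ends G a) ≡ proj₁ (ends G b)) ⊎ (proj₂ (ends G a) ≡ proj₂ (ends G b))

Adj : (G : Graph) → V G → V G → Set
Adj G x y = ∃[ i ] ((ends G i ≡ (x , y)) ⊎ (ends G i ≡ (y , x)))

TriangleFree : Graph → Set
TriangleFree G = ∀ x y z → Adj G x y → Adj G y z → Adj G x z → ⊥

EdgeColoring : Graph → Set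
EdgeColoring G = EdgeIx G → ℕ

ProperEdgeColoring : (G : Graph) → ℕ → EdgeColoring G → Set
ProperEdgeColoring G k c =
  (∀ e → 1 ≤ c e × c e ≤ k) ×
  (∀ e f → ¬ (e ≡ f) → Share G e f → ¬ (c e ≡ c f))

EdgeColorable : Graph → ℕ → Set
EdgeColorable G k = Σ (EdgeColoring G) (ProperEdgeColoring G k)

ChromaticIndex : Graph → ℕ → Set
ChromaticIndex G k = EdgeColorable G k × (∀ j → EdgeColorable G j → k ≤ j)

-- a connected ordering starting with e: position i ↦ edge  Inverse.to σ i
IsConnectedOrdering : (G : Graph) → EdgeIx G → (EdgeIx G ↔ EdgeIx G) → Set
IsConnectedOrdering G e σ =
  (∀ i → toℕ i ≡ 0 → ord i ≡ e) ×
  (∀ i → 0 < toℕ i → ∃[ j ] (j Fin.< i × Share G (ord j) (ord i)))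
  where ord = Inverse.to σ

IsMinFree : ℕ → (ℕ → Set) → Set
IsMinFree x Used = 1 ≤ x × ¬ Used x × (∀ y → 1 ≤ y → y < x → Used y)

IsConnectedGreedy : (G : Graph) → EdgeIx G → ℕ → EdgeColoring G → Set
IsConnectedGreedy G e α c =
  Σ (EdgeIx G ↔ EdgeIx G) λ σ →
    let ord = Inverse.to σ in
    IsConnectedOrdering G e σ ×
    (∀ i → toℕ i ≡ 0 → c (ord i) ≡ α) ×
    (∀ i → 0 < toℕ i →
       IsMinFree (c (ord i))
         (λ col → ∃[ j ] (j Fin.< i × Share G (ord j) (ord i) × c (ord j) ≡ col)))

-- The gadget G'_k(p,q), with n = k-1:  parts P, Q of size n, and p,q,p',q'.

data V₁ (n : ℕ) : Set where
  P  : Fin n → V₁ n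
  Q  : Fin n → V₁ n
  p q p′ q′ : V₁ n

E₁ : (n : ℕ) → List (V₁ n × V₁ n)
E₁ n =
  (p , p′) ∷ (q , q′) ∷
  map (λ i → (p′ , P i)) (allFin n) ++
  map (λ j → (q′ , Q j)) (allFin n) ++
  concatMap (λ i → map (λ j → (P i , Q j)) (allFin n)) (allFin n)

G′ₖpq : ℕ → Graph
G′ₖpq k = record { V = V₁ (k ∸ 1) ; E = E₁ (k ∸ 1) }

-- Copies are indexed by Fin k: copy 0 is G'_k(p,q),
-- copy i (1 ≤ i ≤ k-1) is G'_k(p_i,q_i).  Non-identified vertices of
-- copy c are cP c i, cQ c j, cp′ c, cq′ c; identified vertices are u,v,w;
-- t is the extra vertex.

data V₂ (k : ℕ) : Set where
  cP  : Fin k → Fin (k ∸ 1) → V₂ k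
  cQ  : Fin k → Fin (k ∸ 1) → V₂ k
  cp′ : Fin k → V₂ k
  cq′ : Fin k → V₂ k
  u v w t : V₂ k

emb : {k : ℕ} → Fin k → V₁ (k ∸ 1) → V₂ k
emb c (P i) = cP c i
emb c (Q j) = cQ c j
emb c p′ = cp′ c
emb c q′ = cq′ c
emb Fin.zero p = v
emb (Fin.suc _) p = w
emb Fin.zero q = u
emb (Fin.suc Fin.zero) q = u
emb (Fin.suc (Fin.suc Fin.zero)) q = u
emb (Fin.suc (Fin.suc (Fin.suc Fin.zero))) q = u
emb (Fin.suc (Fin.suc (Fin.suc (Fin.suc _)))) q = v

E₂ : (k : ℕ) → List (V₂ k × V₂ k)
E₂ k =
  (w , t) ∷
  concatMap (λ c → map (λ xy → (emb c (proj₁ xy) , emb c (proj₂ xy))) (E₁ (k ∸ 1))) (allFin k)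

G′ₖ : ℕ → Graph
G′ₖ k = record { V = V₂ k ; E = E₂ k }

{-# OPTIONS --safe #-}
-- (1) Every vertex of G′ₖ(p,q) other than p and q has degree k, so it sees all k colours. The colour
-- of pp′ is then carried by a perfect matching between P and Q, so every vertex of Q already sees it
-- and q′ can only see it on qq′.
-- (2) Colour the edges by residues mod k of an affine expression in the indices (pp′ and qq′ get g,
-- p′Pᵢ and q′Qⱼ get g + i + 1, PᵢQⱼ gets g + i + j + 2): the colours around a vertex are consecutive
-- residues. A proper colouring is connected greedy as soon as its edges can be levelled so that the
-- first edge is lowest and every other edge meets a lower edge, and a lower edge of each smaller
-- colour; here the levels are pp′ < p′P < PQ < Qq′ < qq′, refined by colour.
-- (3) G′ₖ maps onto the 5-cycle, so it has no triangle; w has degree k, and the colourings of (2)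
-- shifted by the copy number fit together into a k-colouring. In a greedy colouring starting with α on
-- wt, the two poles of every copy share a colour by (1), and at w this forces the poles of copy 0 to
-- have colour α. The first edge of copy 0 to be coloured is a pole entered from v or from u, and the
-- colours below α must already be present there, on at most k − 4 other edges: α ≤ k − 3. Conversely,
-- if α ≤ k − 3 then colouring copy 0 last leaves the colours below α waiting at v.
module Submission where

open import Defs
open import Level using (0ℓ)
open import Data.Bool using (Bool; T; T?; _∨_)
open import Data.Bool.Properties using (∨-comm)
open import Data.Nat as ℕ using (ℕ; zero; suc; _+_; _*_; _∸_; _≤_; _<_; z≤n; s≤s; NonZero; _≡ᵇ_; _≟_)
open import Data.Nat.Properties as ℕ
  using (≤-refl; ≤-trans; <-trans; <-≤-trans; ≤-<-trans; <-irrefl; <-asym; <-cmp; <⇒≢; ≤-antisym; 1+n≰n;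
         n<1+n; n≤1+n; m≤m+n; +-comm; +-cancelˡ-≡; +-monoʳ-<; +-mono-≤-<; *-monoˡ-≤; *-distribʳ-∸;
         m∸n≤m; m∸n≡0⇒m≤n; [m+n]∸[m+o]≡n∸o; m≤n⇒∃[o]m+o≡n; +-commutativeSemigroup)
open import Algebra.Properties.CommutativeSemigroup +-commutativeSemigroup using (x∙yz≈y∙xz; xy∙z≈xz∙y)
open import Data.Nat.DivMod using (_%_; _/_; m≡m%n+[m/n]*n; m%n<n; m<n⇒m%n≡m; %-remove-+ˡ)
open import Data.Nat.Divisibility using (_∣_; divides; >⇒∤; ∣-refl)
open import Data.Fin as Fin using (Fin; toℕ; fromℕ<; punchOut; inject; #_)
open import Data.Fin.Properties as Fin
  using (toℕ<n; toℕ-fromℕ<; toℕ-injective; toℕ-inject; 0≢1+n; punchOut-injective; injective⇒≤;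
         any?; all?; ¬∀⟶∃¬-smallest)
open import Data.Fin.Subset using (Subset; ∣_∣) renaming (_∈_ to _∈ˢ_; _∉_ to _∉ˢ_)
open import Data.Fin.Subset.Properties using (p⊂q⇒∣p∣<∣q∣; ∈⊤; ∣⊤∣≡n; Empty-unique; ∣⊥∣≡0)
open import Data.Vec using (tabulate)
open import Data.Vec.Properties using (lookup∘tabulate; lookup⇒[]=; []=⇒lookup)
open import Data.List using (List; _∷_; map; concatMap; _++_; lookup; allFin)
open import Data.List.Membership.Propositional using (_∈_)
open import Data.List.Membership.Propositional.Properties
  using (∈-lookup; ∈-map⁺; ∈-map⁻; ∈-++⁺ˡ; ∈-++⁺ʳ; ∈-++⁻; ∈-concatMap⁺; ∈-concatMap⁻; ∈-allFin)
open import Data.List.Relation.Unary.Any as Any using (here; there; satisfied)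
open import Data.List.Relation.Unary.Any.Properties using (lookup-index)
import Data.List.Relation.Unary.All as All
import Data.List.Relation.Unary.All.Properties as All
open import Data.List.Relation.Unary.AllPairs using (_∷_)
import Data.List.Relation.Unary.AllPairs.Properties as AllPairs
open import Data.List.Relation.Unary.Unique.Propositional using (Unique)
import Data.List.Relation.Unary.Unique.Propositional.Properties as Unique
open import Data.List.Relation.Binary.Disjoint.Propositional using (Disjoint)
open import Data.Maybe using (Maybe; just; nothing)
open import Data.Maybe.Properties using (just-injective)
open import Data.Product using (Σ; ∃; ∃₂; ∃-syntax; _×_; _,_; proj₁; proj₂)
open import Data.Sum using (_⊎_; inj₁; inj₂)
open import Data.Empty using (⊥)
open import Function using (_∘_)
open import Function.Bundles using (_↔_; _⇔_; Inverse; mk↔ₛ′; mk⇔)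
open import Function.Definitions using (Injective)
open import Relation.Nullary using (¬_; Dec; yes; no; does; contradiction; ¬?)
open import Relation.Nullary.Decidable using (_×-dec_; dec-true; dec-false; decidable-stable; toWitness)
open import Relation.Unary using (Pred; Decidable)
open import Relation.Binary using (tri<; tri≈; tri>)
open import Relation.Binary.PropositionalEquality
  using (_≡_; _≢_; refl; sym; trans; cong; cong₂; subst; subst₂; module ≡-Reasoning)

injective⇒surjective : ∀ {n} {f : Fin n → Fin n} → Injective _≡_ _≡_ f → ∀ j → ∃ λ i → f i ≡ j
injective⇒surjective {suc n} {f} f-injective j with any? (λ i → f i Fin.≟ j)
... | yes hit = hit
... | no miss = contradiction (injective⇒≤ punched-injective) 1+n≰n
  where
  punched : Fin (suc n) → Fin n
  punched i = punchOut {i = j} λ j≡fi → miss (i , sym j≡fi)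

  punched-injective : Injective _≡_ _≡_ punched
  punched-injective eq = f-injective (punchOut-injective {i = j} _ _ eq)

least : ∀ {n} {S : Pred (Fin n) 0ℓ} → Decidable S → ∀ {i} → S i →
        ∃ λ j → S j × (∀ i → i Fin.< j → ¬ S i)
least {n} {S} S? {i} Si with ¬∀⟶∃¬-smallest n (¬_ ∘ S) (¬? ∘ S?) (λ none → none i Si)
... | j , ¬¬Sj , before =
  j , decidable-stable (S? j) ¬¬Sj , λ i i<j → subst (¬_ ∘ S) (inject-fromℕ< i<j) (before (fromℕ< i<j))
  where
  inject-fromℕ< : ∀ {i j : Fin n} (i<j : i Fin.< j) → inject (fromℕ< i<j) ≡ i
  inject-fromℕ< i<j = toℕ-injective (trans (toℕ-inject (fromℕ< i<j)) (toℕ-fromℕ< i<j))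

-- Colours and residues

colourIndex : ∀ {k x} → 1 ≤ x × x ≤ k → Fin k
colourIndex {x = suc x} (_ , x<k) = fromℕ< x<k

colourIndex-injective : ∀ {k x y} (x∈ : 1 ≤ x × x ≤ k) (y∈ : 1 ≤ y × y ≤ k) →
                        colourIndex x∈ ≡ colourIndex y∈ → x ≡ y
colourIndex-injective {x = suc x} {suc y} (_ , x<k) (_ , y<k) eq =
  cong suc (trans (sym (toℕ-fromℕ< x<k)) (trans (cong toℕ eq) (toℕ-fromℕ< y<k)))

module _ {m} {f : Fin m → ℕ} (f-injective : Injective _≡_ _≡_ f) where

  injective-colours⇒≤ : ∀ {k} → (∀ i → 1 ≤ f i × f i ≤ k) → m ≤ k
  injective-colours⇒≤ f∈ = injective⇒≤ (f-injective ∘ colourIndex-injective (f∈ _) (f∈ _))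

  injective-colours-exhaust : (∀ i → 1 ≤ f i × f i ≤ m) → ∀ y → 1 ≤ y × y ≤ m → ∃ λ i → f i ≡ y
  injective-colours-exhaust f∈ y y∈ =
    let (i , hit) = injective⇒surjective (f-injective ∘ colourIndex-injective (f∈ _) (f∈ _)) (colourIndex y∈)
    in i , colourIndex-injective (f∈ i) y∈ hit

colours-covered⇒≤ : ∀ {b α} (f : Fin b → ℕ) → (∀ y → 1 ≤ y → y ≤ α → ∃ λ i → f i ≡ y) → α ≤ b
colours-covered⇒≤ {α = α} f covered = injective⇒≤ {f = source} source-injective
  where
  source : Fin α → Fin _
  source y = proj₁ (covered (suc (toℕ y)) (s≤s z≤n) (toℕ<n y))

  source-injective : Injective _≡_ _≡_ source
  source-injective {y} {y′} eq = toℕ-injective (ℕ.suc-injective (begin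
    suc (toℕ y)   ≡⟨ sym (proj₂ (covered _ (s≤s z≤n) (toℕ<n y))) ⟩
    f (source y)  ≡⟨ cong f eq ⟩
    f (source y′) ≡⟨ proj₂ (covered _ (s≤s z≤n) (toℕ<n y′)) ⟩
    suc (toℕ y′)  ∎))
    where open ≡-Reasoning

%-≡⇒∣∸ : ∀ m n k .{{_ : NonZero k}} → m % k ≡ n % k → k ∣ m ∸ n
%-≡⇒∣∸ m n k eq = divides (m / k ∸ n / k) (begin
  m ∸ n                                      ≡⟨ cong₂ _∸_ (m≡m%n+[m/n]*n m k) (m≡m%n+[m/n]*n n k) ⟩
  (m % k + m / k * k) ∸ (n % k + n / k * k)  ≡⟨ cong (λ r → (r + m / k * k) ∸ (n % k + n / k * k)) eq ⟩
  (n % k + m / k * k) ∸ (n % k + n / k * k)  ≡⟨ [m+n]∸[m+o]≡n∸o (n % k) _ _ ⟩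
  m / k * k ∸ n / k * k                      ≡⟨ sym (*-distribʳ-∸ k (m / k) (n / k)) ⟩
  (m / k ∸ n / k) * k                        ∎)
  where open ≡-Reasoning

+-%-injectiveˡ : ∀ k .{{_ : NonZero k}} X {a b} → a < k → b < k → (a + X) % k ≡ (b + X) % k → a ≡ b
+-%-injectiveˡ k X a<k b<k eq = ≤-antisym (≤-of-residues a<k eq) (≤-of-residues b<k (sym eq))
  where
  small-multiple : ∀ {d} → k ∣ d → d < k → d ≡ 0
  small-multiple {zero} _ _ = refl
  small-multiple {suc d} k∣d d<k = contradiction k∣d (>⇒∤ d<k)

  ≤-of-residues : ∀ {a b} → a < k → (a + X) % k ≡ (b + X) % k → a ≤ b
  ≤-of-residues {a} {b} a<k eq = m∸n≡0⇒m≤n (small-multiple k∣a∸b (≤-<-trans (m∸n≤m a b) a<k))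
    where
    k∣a∸b : k ∣ a ∸ b
    k∣a∸b = subst (k ∣_) (trans (cong₂ _∸_ (+-comm a X) (+-comm b X)) ([m+n]∸[m+o]≡n∸o X a b))
                  (%-≡⇒∣∸ (a + X) (b + X) k eq)

colourMod : ∀ k .{{_ : NonZero k}} → ℕ → ℕ
colourMod k x = suc (x % k)

colourMod-bounds : ∀ k .{{_ : NonZero k}} x → 1 ≤ colourMod k x × colourMod k x ≤ k
colourMod-bounds k x = s≤s z≤n , m%n<n x k

colourMod-small : ∀ {k} .{{_ : NonZero k}} {x} → x < k → colourMod k x ≡ suc x
colourMod-small x<k = cong suc (m<n⇒m%n≡m x<k)

colourMod-injective : ∀ k .{{_ : NonZero k}} X {a b} → a < k → b < k →
                      colourMod k (a + X) ≡ colourMod k (b + X) → a ≡ b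
colourMod-injective k X a<k b<k eq = +-%-injectiveˡ k X a<k b<k (ℕ.suc-injective eq)

-- Ordering edges by levels

lex-<ˡ : ∀ {K a b x y} → x < K → a < b → a * K + x < b * K + y
lex-<ˡ {K} {a} {b} {x} {y} x<K a<b = begin-strict
  a * K + x  <⟨ +-monoʳ-< (a * K) x<K ⟩
  a * K + K  ≡⟨ +-comm (a * K) K ⟩
  suc a * K  ≤⟨ *-monoˡ-≤ K a<b ⟩
  b * K      ≤⟨ m≤m+n (b * K) y ⟩
  b * K + y  ∎
  where open ℕ.≤-Reasoning

lex-<ʳ : ∀ {K a b x y} → a ≤ b → x < y → a * K + x < b * K + y
lex-<ʳ {K} a≤b x<y = +-mono-≤-< (*-monoˡ-≤ K a≤b) x<y

module RankBy {N} (key : Fin N → ℕ) (key-injective : Injective _≡_ _≡_ key) where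

  below : Fin N → Subset N
  below e = tabulate λ g → does (key g ℕ.<? key e)

  ∈-below : ∀ {g e} → key g < key e → g ∈ˢ below e
  ∈-below {g} {e} g<e = lookup⇒[]= g (below e) (trans (lookup∘tabulate _ g) (dec-true (key g ℕ.<? key e) g<e))

  ∈-below⁻ : ∀ {g e} → g ∈ˢ below e → key g < key e
  ∈-below⁻ {g} {e} g∈ = decidable-stable (key g ℕ.<? key e) λ g≮e →
    contradiction (trans (sym (dec-false (key g ℕ.<? key e) g≮e))
                         (trans (sym (lookup∘tabulate _ g)) ([]=⇒lookup g∈))) λ ()

  ∉-below-self : ∀ {e} → e ∉ˢ below e
  ∉-below-self e∈ = <-irrefl refl (∈-below⁻ e∈)

  rank : Fin N → ℕ
  rank e = ∣ below e ∣

  rank-mono : ∀ {f e} → key f < key e → rank f < rank e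
  rank-mono {f} f<e =
    p⊂q⇒∣p∣<∣q∣ ((λ g∈ → ∈-below (<-trans (∈-below⁻ g∈) f<e)) , f , ∈-below f<e , ∉-below-self)

  rank<N : ∀ e → rank e < N
  rank<N e = subst (rank e <_) (∣⊤∣≡n N) (p⊂q⇒∣p∣<∣q∣ ((λ _ → ∈⊤) , e , ∈⊤ , ∉-below-self))

  position : Fin N → Fin N
  position e = fromℕ< (rank<N e)

  position-mono : ∀ {f e} → key f < key e → position f Fin.< position e
  position-mono f<e = subst₂ _<_ (sym (toℕ-fromℕ< _)) (sym (toℕ-fromℕ< _)) (rank-mono f<e)

  position-least : ∀ {e} → (∀ g → ¬ key g < key e) → toℕ (position e) ≡ 0
  position-least {e} minimal = trans (toℕ-fromℕ< (rank<N e))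
    (trans (cong ∣_∣ (Empty-unique λ (g , g∈) → minimal g (∈-below⁻ g∈))) (∣⊥∣≡0 N))

  position-injective : Injective _≡_ _≡_ position
  position-injective {e} {f} eq with <-cmp (key e) (key f)
  ... | tri< e<f _ _ = contradiction (cong toℕ eq) (ℕ.<⇒≢ (position-mono e<f))
  ... | tri≈ _ e≈f _ = key-injective e≈f
  ... | tri> _ _ f<e = contradiction (cong toℕ (sym eq)) (ℕ.<⇒≢ (position-mono f<e))

  element-at : Fin N → Fin N
  element-at i = proj₁ (injective⇒surjective position-injective i)

  position-element-at : ∀ i → position (element-at i) ≡ i
  position-element-at i = proj₂ (injective⇒surjective position-injective i)

  element-at-position : ∀ e → element-at (position e) ≡ e
  element-at-position e = position-injective (position-element-at (position e))

  ordering : Fin N ↔ Fin N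
  ordering = mk↔ₛ′ element-at position element-at-position position-element-at

Incident : {X : Set} → X → X × X → Set
Incident x a = proj₁ a ≡ x ⊎ proj₂ a ≡ x

-- Share G e f unfolds to Meet (ends G e) (ends G f), and ProperEdgeColoring G to ProperOn (ends G).
Meet : {X : Set} → X × X → X × X → Set
Meet a b = (proj₁ a ≡ proj₁ b) ⊎ (proj₁ a ≡ proj₂ b) ⊎ (proj₂ a ≡ proj₁ b) ⊎ (proj₂ a ≡ proj₂ b)

meet⇒common : ∀ {X} {a b : X × X} → Meet a b → ∃ λ x → Incident x a × Incident x b
meet⇒common {b = b} (inj₁ eq) = proj₁ b , inj₁ eq , inj₁ refl
meet⇒common {b = b} (inj₂ (inj₁ eq)) = proj₂ b , inj₁ eq , inj₂ refl
meet⇒common {b = b} (inj₂ (inj₂ (inj₁ eq))) = proj₁ b , inj₂ eq , inj₁ refl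
meet⇒common {b = b} (inj₂ (inj₂ (inj₂ eq))) = proj₂ b , inj₂ eq , inj₂ refl

common⇒meet : ∀ {X} {x : X} {a b} → Incident x a → Incident x b → Meet a b
common⇒meet (inj₁ a₁≡x) (inj₁ b₁≡x) = inj₁ (trans a₁≡x (sym b₁≡x))
common⇒meet (inj₁ a₁≡x) (inj₂ b₂≡x) = inj₂ (inj₁ (trans a₁≡x (sym b₂≡x)))
common⇒meet (inj₂ a₂≡x) (inj₁ b₁≡x) = inj₂ (inj₂ (inj₁ (trans a₂≡x (sym b₁≡x))))
common⇒meet (inj₂ a₂≡x) (inj₂ b₂≡x) = inj₂ (inj₂ (inj₂ (trans a₂≡x (sym b₂≡x))))

Meet-sym : ∀ {X} {a b : X × X} → Meet a b → Meet b a
Meet-sym a~b = let (_ , x∈a , x∈b) = meet⇒common a~b in common⇒meet x∈b x∈a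

ProperOn : {X D : Set} → (D → X × X) → ℕ → (D → ℕ) → Set
ProperOn endpoints k col =
  (∀ d → 1 ≤ col d × col d ≤ k) ×
  (∀ d d′ → d ≢ d′ → Meet (endpoints d) (endpoints d′) → col d ≢ col d′)

-- Connected greedy colourings

record GreedyCertificate {X : Set} (Meets : X → X → Set) (x₀ : X) (α : ℕ) (c : X → ℕ) : Set where
  field
    level : X → ℕ
    first-colour : c x₀ ≡ α
    positive : ∀ x → x ≢ x₀ → 1 ≤ c x
    separating : ∀ x y → Meets x y → c x ≡ c y → x ≡ y
    first-lowest : ∀ x → x ≢ x₀ → level x₀ < level x
    grounded : ∀ x → x ≢ x₀ → ∃ λ y → Meets y x × level y < level x
    supported : ∀ x → x ≢ x₀ → ∀ col → 1 ≤ col → col < c x →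
                ∃ λ y → Meets y x × c y ≡ col × level y < level x

-- Listing the edges by level, ties broken by index, puts the witnesses of grounded and supported earlier.
module _ {G : Graph} {e₀ α c} (cert : GreedyCertificate (Share G) e₀ α c) where
  open GreedyCertificate cert

  private
    N : ℕ
    N = ∣E∣ G

    key : EdgeIx G → ℕ
    key e = level e * N + toℕ e

    key-mono : ∀ {f e} → level f < level e → key f < key e
    key-mono {f} = lex-<ˡ (toℕ<n f)

    key-injective : Injective _≡_ _≡_ key
    key-injective {e} {f} eq with <-cmp (level e) (level f)
    ... | tri< e<f _ _ = contradiction eq (<⇒≢ (key-mono e<f))
    ... | tri> _ _ f<e = contradiction (sym eq) (<⇒≢ (key-mono f<e))
    ... | tri≈ _ same _ =
      toℕ-injective (+-cancelˡ-≡ (level e * N) _ _ (trans eq (cong (λ l → l * N + toℕ f) (sym same))))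

    open RankBy key key-injective

    nothing-below-e₀ : ∀ g → ¬ key g < key e₀
    nothing-below-e₀ g g<e₀ with g Fin.≟ e₀
    ... | yes refl = <-irrefl refl g<e₀
    ... | no g≢e₀ = <-asym g<e₀ (key-mono (first-lowest g g≢e₀))

    e₀-first : toℕ (position e₀) ≡ 0
    e₀-first = position-least nothing-below-e₀

    starts-with-e₀ : ∀ i → toℕ i ≡ 0 → element-at i ≡ e₀
    starts-with-e₀ i i≡0 =
      trans (cong element-at (toℕ-injective (trans i≡0 (sym e₀-first)))) (element-at-position e₀)

    not-e₀ : ∀ i → 0 < toℕ i → element-at i ≢ e₀
    not-e₀ i 0<i eq = <⇒≢ 0<i (sym (begin
      toℕ i                         ≡⟨ cong toℕ (sym (position-element-at i)) ⟩
      toℕ (position (element-at i)) ≡⟨ cong (toℕ ∘ position) eq ⟩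
      toℕ (position e₀)             ≡⟨ e₀-first ⟩
      0                             ∎))
      where open ≡-Reasoning

    earlier : ∀ i f → level f < level (element-at i) → position f Fin.< i
    earlier i f lt = subst (position f Fin.<_) (position-element-at i) (position-mono (key-mono lt))

    as-element : ∀ f {e} → Share G f e → Share G (element-at (position f)) e
    as-element f = subst (λ g → Share G g _) (sym (element-at-position f))

  certificate⇒connectedGreedy : IsConnectedGreedy G e₀ α c
  certificate⇒connectedGreedy =
    ordering , (starts-with-e₀ , connected) ,
    (λ i i≡0 → trans (cong c (starts-with-e₀ i i≡0)) first-colour) , greedy
    where
    connected : ∀ i → 0 < toℕ i → ∃[ j ] (j Fin.< i × Share G (element-at j) (element-at i))
    connected i 0<i = let (f , f~e , f<e) = grounded (element-at i) (not-e₀ i 0<i) in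
      position f , earlier i f f<e , as-element f f~e

    greedy : ∀ i → 0 < toℕ i → IsMinFree (c (element-at i))
               (λ col → ∃[ j ] (j Fin.< i × Share G (element-at j) (element-at i) × c (element-at j) ≡ col))
    greedy i 0<i = positive e e≢e₀ , fresh , smaller-used
      where
      e : EdgeIx G
      e = element-at i

      e≢e₀ : e ≢ e₀
      e≢e₀ = not-e₀ i 0<i

      fresh : ¬ (∃[ j ] (j Fin.< i × Share G (element-at j) e × c (element-at j) ≡ c e))
      fresh (j , j<i , j~i , same) = <⇒≢ j<i (cong toℕ (begin
        j                                ≡⟨ sym (position-element-at j) ⟩
        position (element-at j)          ≡⟨ cong position (separating _ _ j~i same) ⟩
        position e                       ≡⟨ position-element-at i ⟩
        i                                ∎))
        where open ≡-Reasoning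

      smaller-used : ∀ y → 1 ≤ y → y < c e →
                     ∃[ j ] (j Fin.< i × Share G (element-at j) e × c (element-at j) ≡ y)
      smaller-used y 1≤y y<c = let (f , f~e , cf≡y , f<e) = supported e e≢e₀ y 1≤y y<c in
        position f , earlier i f f<e , as-element f f~e , trans (cong c (element-at-position f)) cf≡y

zero-or-positive : ∀ {n} (i : Fin n) → toℕ i ≡ 0 ⊎ 0 < toℕ i
zero-or-positive Fin.zero = inj₁ refl
zero-or-positive (Fin.suc _) = inj₂ (s≤s z≤n)

zero-of : ∀ {n} → Fin n → Σ (Fin n) λ i → toℕ i ≡ 0
zero-of Fin.zero = Fin.zero , refl
zero-of (Fin.suc _) = Fin.zero , refl

module ConnectedGreedy {G : Graph} {e₀ α c} (greedy : IsConnectedGreedy G e₀ α c) where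

  private
    σ : EdgeIx G ↔ EdgeIx G
    σ = proj₁ greedy

    order position : EdgeIx G → EdgeIx G
    order = Inverse.to σ
    position = Inverse.from σ

    at-position : ∀ e → order (position e) ≡ e
    at-position = Inverse.strictlyInverseˡ σ

    starts : ∀ i → toℕ i ≡ 0 → order i ≡ e₀
    starts = proj₁ (proj₁ (proj₂ greedy))

    connected : ∀ i → 0 < toℕ i → ∃[ j ] (j Fin.< i × Share G (order j) (order i))
    connected = proj₂ (proj₁ (proj₂ greedy))

    first : ∀ i → toℕ i ≡ 0 → c (order i) ≡ α
    first = proj₁ (proj₂ (proj₂ greedy))

    min-free : ∀ i → 0 < toℕ i → IsMinFree (c (order i))
                 (λ col → ∃[ j ] (j Fin.< i × Share G (order j) (order i) × c (order j) ≡ col))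
    min-free = proj₂ (proj₂ (proj₂ greedy))

    coloured-later : ∀ {e f} → toℕ (position e) < toℕ (position f) → Share G e f → c e ≢ c f
    coloured-later {e} {f} lt e~f same = proj₁ (proj₂ (min-free (position f) (≤-<-trans z≤n lt)))
      (position e , lt , subst₂ (Share G) (sym (at-position e)) (sym (at-position f)) e~f ,
       trans (cong c (at-position e)) (trans same (sym (cong c (at-position f)))))

  first-colour : c e₀ ≡ α
  first-colour = let (i , i≡0) = zero-of e₀ in trans (cong c (sym (starts i i≡0))) (first i i≡0)

  positive : 1 ≤ α → ∀ e → 1 ≤ c e
  positive 1≤α e with zero-or-positive (position e)
  ... | inj₁ at-0 = subst (λ f → 1 ≤ c f) (at-position e) (subst (1 ≤_) (sym (first _ at-0)) 1≤α)
  ... | inj₂ 0<i = subst (λ f → 1 ≤ c f) (at-position e) (proj₁ (min-free _ 0<i))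

  proper : ∀ e f → e ≢ f → Share G e f → c e ≢ c f
  proper e f e≢f e~f with <-cmp (toℕ (position e)) (toℕ (position f))
  ... | tri< e<f _ _ = coloured-later e<f e~f
  ... | tri> _ _ f<e = coloured-later f<e (Meet-sym e~f) ∘ sym
  ... | tri≈ _ same _ =
    contradiction (trans (sym (at-position e)) (trans (cong order (toℕ-injective same)) (at-position f))) e≢f

  first-entry : ∀ {S : Pred (EdgeIx G) 0ℓ} → Decidable S → ¬ S e₀ → ∀ {e} → S e →
                ∃ λ e* → S e* × (∃ λ f → ¬ S f × Share G f e*) ×
                         (∀ y → 1 ≤ y → y < c e* → ∃ λ f → ¬ S f × Share G f e* × c f ≡ y)
  first-entry {S} S? e₀∉S {e} e∈S with least (S? ∘ order) (subst S (sym (at-position e)) e∈S)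
  ... | j , Sj , before with zero-or-positive j
  ...   | inj₁ j≡0 = contradiction (subst S (starts j j≡0) Sj) e₀∉S
  ...   | inj₂ 0<j = order j , Sj , neighbour , colours
    where
    neighbour : ∃ λ f → ¬ S f × Share G f (order j)
    neighbour with connected j 0<j
    ... | i , i<j , i~j = order i , before i i<j , i~j

    colours : ∀ y → 1 ≤ y → y < c (order j) → ∃ λ f → ¬ S f × Share G f (order j) × c f ≡ y
    colours y 1≤y y<c with proj₂ (proj₂ (min-free j 0<j)) y 1≤y y<c
    ... | i , i<j , i~j , ci≡y = order i , before i i<j , i~j , ci≡y

-- Graphs coded by a type of edges

lookup-injective : ∀ {A : Set} {xs : List A} → Unique xs → Injective _≡_ _≡_ (lookup xs)
lookup-injective (_ ∷ _) {Fin.zero} {Fin.zero} _ = refl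
lookup-injective (x∉ ∷ _) {Fin.zero} {Fin.suc j} eq = contradiction eq (All.lookup x∉ (∈-lookup j))
lookup-injective (x∉ ∷ _) {Fin.suc i} {Fin.zero} eq = contradiction (sym eq) (All.lookup x∉ (∈-lookup i))
lookup-injective (_ ∷ xs!) {Fin.suc i} {Fin.suc j} eq = cong Fin.suc (lookup-injective xs! eq)

record EdgeCoding (G : Graph) : Set₁ where
  field
    Edge : Set
    endpoints : Edge → V G × V G
    endpoints-injective : Injective _≡_ _≡_ endpoints
    index : Edge → EdgeIx G
    edge : EdgeIx G → Edge
    ends-index : ∀ d → ends G (index d) ≡ endpoints d
    index-edge : ∀ e → index (edge e) ≡ e
    edge-index : ∀ d → edge (index d) ≡ d

  Meets : Edge → Edge → Set
  Meets d d′ = Meet (endpoints d) (endpoints d′)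

  ends-edge : ∀ e → ends G e ≡ endpoints (edge e)
  ends-edge e = trans (cong (ends G) (sym (index-edge e))) (ends-index (edge e))

  edge-by-ends : ∀ {e d} → ends G e ≡ endpoints d → edge e ≡ d
  edge-by-ends {e} eq = endpoints-injective (trans (sym (ends-edge e)) eq)

  index-by-ends : ∀ {e d} → ends G e ≡ endpoints d → e ≡ index d
  index-by-ends {e} eq = trans (sym (index-edge e)) (cong index (edge-by-ends eq))

  index-injective : Injective _≡_ _≡_ index
  index-injective {d} {d′} eq = trans (sym (edge-index d)) (trans (cong edge eq) (edge-index d′))

  edge-injective : Injective _≡_ _≡_ edge
  edge-injective {e} {e′} eq = trans (sym (index-edge e)) (trans (cong index eq) (index-edge e′))

  share⇒meets : ∀ {e f} → Share G e f → Meets (edge e) (edge f)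
  share⇒meets {e} {f} = subst₂ Meet (ends-edge e) (ends-edge f)

  meets⇒share : ∀ {d d′} → Meets d d′ → Share G (index d) (index d′)
  meets⇒share {d} {d′} = subst₂ Meet (sym (ends-index d)) (sym (ends-index d′))

  proper-restrict : ∀ {k c} → ProperEdgeColoring G k c → ProperOn endpoints k (c ∘ index)
  proper-restrict (c∈ , c-proper) =
    (λ d → c∈ (index d)) , λ d d′ d≢d′ d~d′ → c-proper _ _ (d≢d′ ∘ index-injective) (meets⇒share d~d′)

  proper-extend : ∀ {k col} → ProperOn endpoints k col → ProperEdgeColoring G k (col ∘ edge)
  proper-extend (col∈ , col-proper) =
    (λ e → col∈ (edge e)) , λ e f e≢f e~f → col-proper _ _ (e≢f ∘ edge-injective) (share⇒meets e~f)

  certificate-extend : ∀ {d₀ α col} → GreedyCertificate Meets d₀ α col →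
                       GreedyCertificate (Share G) (index d₀) α (col ∘ edge)
  certificate-extend {d₀} {col = col} cert = record
    { level = level ∘ edge
    ; first-colour = trans (cong col (edge-index d₀)) first-colour
    ; positive = λ e e≢ → positive (edge e) (not-first e≢)
    ; separating = λ e f e~f same → edge-injective (separating _ _ (share⇒meets e~f) same)
    ; first-lowest = λ e e≢ →
        subst (λ d → level d < _) (sym (edge-index d₀)) (first-lowest (edge e) (not-first e≢))
    ; grounded = λ e e≢ → let (d , d~e , lower) = grounded (edge e) (not-first e≢) in
        index d , share-at d d~e , subst (λ d′ → level d′ < _) (sym (edge-index d)) lower
    ; supported = λ e e≢ y 1≤y y<c →
        let (d , d~e , cd≡y , lower) = supported (edge e) (not-first e≢) y 1≤y y<c in
        index d , share-at d d~e , trans (cong col (edge-index d)) cd≡y ,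
        subst (λ d′ → level d′ < _) (sym (edge-index d)) lower
    }
    where
    open GreedyCertificate cert

    not-first : ∀ {e} → e ≢ index d₀ → edge e ≢ d₀
    not-first e≢ eq = e≢ (trans (sym (index-edge _)) (cong index eq))

    share-at : ∀ {e} d → Meets d (edge e) → Share G (index d) e
    share-at {e} d d~e = subst (Share G (index d)) (index-edge e) (meets⇒share d~e)

  greedy-proper : ∀ {e₀ α c k} → IsConnectedGreedy G e₀ α c → 1 ≤ α → (∀ e → c e ≤ k) →
                  ProperOn endpoints k (c ∘ index)
  greedy-proper {c = c} greedy 1≤α c≤k = proper-restrict ((λ e → positive 1≤α e , c≤k e) , proper)
    where open ConnectedGreedy {G = G} {c = c} greedy

  greedy-first : ∀ {e₀ α c} → IsConnectedGreedy G e₀ α c → c (index (edge e₀)) ≡ α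
  greedy-first {e₀} {c = c} greedy =
    trans (cong c (index-edge e₀)) (ConnectedGreedy.first-colour {G = G} {c = c} greedy)

  greedy-entry : ∀ {e₀ α c} → IsConnectedGreedy G e₀ α c →
                 ∀ {S : Pred Edge 0ℓ} → Decidable S → ¬ S (edge e₀) → ∀ {d} → S d →
                 ∃ λ d* → S d* × (∃ λ f → ¬ S f × Meets f d*) ×
                          (∀ y → 1 ≤ y → y < c (index d*) → ∃ λ f → ¬ S f × Meets f d* × c (index f) ≡ y)
  greedy-entry {c = c} greedy {S} S? e₀∉S {d} d∈S =
    let (e* , e*∈S , (f , f∉S , f~e*) , colours) =
          first-entry {S = S ∘ edge} (S? ∘ edge) e₀∉S (subst S (sym (edge-index d)) d∈S)
    in edge e* , e*∈S , (edge f , f∉S , share⇒meets f~e*) , λ y 1≤y y<c →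
         let (g , g∉S , g~e* , cg≡y) = colours y 1≤y (subst (y <_) (cong c (index-edge e*)) y<c)
         in edge g , g∉S , share⇒meets g~e* , trans (cong c (index-edge g)) cg≡y
    where open ConnectedGreedy {G = G} {c = c} greedy

codingFromList : ∀ {G : Graph} {D : Set} (endpoints : D → V G × V G) → Injective _≡_ _≡_ endpoints →
                 Unique (E G) → (∀ d → endpoints d ∈ E G) → (∀ {x} → x ∈ E G → ∃ λ d → endpoints d ≡ x) →
                 EdgeCoding G
codingFromList {G} {D} endpoints endpoints-injective unique listed classify = record
  { Edge = D
  ; endpoints = endpoints
  ; endpoints-injective = endpoints-injective
  ; index = index
  ; edge = edge
  ; ends-index = ends-index
  ; index-edge = λ e → lookup-injective unique (trans (ends-index (edge e)) (proj₂ (classify (∈-lookup e))))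
  ; edge-index = λ d → endpoints-injective (trans (proj₂ (classify (∈-lookup (index d)))) (ends-index d))
  }
  where
  index : D → EdgeIx G
  index d = Any.index (listed d)

  edge : EdgeIx G → D
  edge e = proj₁ (classify (∈-lookup e))

  ends-index : ∀ d → ends G (index d) ≡ endpoints d
  ends-index d = sym (lookup-index (listed d))

lexLevel : {D : Set} → (block : D → ℕ) → (col : D → ℕ) → ℕ → D → ℕ
lexLevel block col K d = block d * K + col d

record Stars {X D : Set} (endpoints : D → X × X) : Set where
  field
    degree : X → ℕ
    star : (x : X) → Fin (degree x) → D
    star-incident : ∀ x s → Incident x (endpoints (star x s))
    incident⇒star : ∀ x d → Incident x (endpoints d) → ∃ λ s → star x s ≡ d

  separating-if-starwise-injective : ∀ {col : D → ℕ} → (∀ x → Injective _≡_ _≡_ (col ∘ star x)) →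
                                     ∀ d d′ → Meet (endpoints d) (endpoints d′) → col d ≡ col d′ → d ≡ d′
  separating-if-starwise-injective {col} starwise d d′ d~d′ same =
    let (x , x∈d , x∈d′) = meet⇒common d~d′
        (s , s↦d) = incident⇒star x d x∈d
        (s′ , s′↦d′) = incident⇒star x d′ x∈d′
        same-at-x = trans (cong col s↦d) (trans same (sym (cong col s′↦d′)))
    in trans (sym s↦d) (trans (cong (star x) (starwise x same-at-x)) s′↦d′)

  starwise-injective : ∀ {k col} → (∀ x → Injective _≡_ _≡_ (star x)) → ProperOn endpoints k col →
                       ∀ x → Injective _≡_ _≡_ (col ∘ star x)
  starwise-injective star-injective (_ , col-proper) x {s} {s′} same with s Fin.≟ s′
  ... | yes s≡s′ = s≡s′
  ... | no s≢s′ = contradiction same (col-proper _ _ (s≢s′ ∘ star-injective x)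
                    (common⇒meet (star-incident x s) (star-incident x s′)))

  degree≤colours : ∀ {k col} → (∀ x → Injective _≡_ _≡_ (star x)) → ProperOn endpoints k col →
                   ∀ x → degree x ≤ k
  degree≤colours star-injective proper x =
    injective-colours⇒≤ (starwise-injective star-injective proper x) (λ s → proj₁ proper (star x s))

  full-star-supplies : ∀ (block col : D → ℕ) {K} → (∀ d → col d < K) → ∀ x →
    Injective _≡_ _≡_ (col ∘ star x) → (∀ s → 1 ≤ col (star x s) × col (star x s) ≤ degree x) →
    ∀ d → Incident x (endpoints d) → col d ≤ degree x → (∀ s → block (star x s) ≤ block d) →
    ∀ y → 1 ≤ y → y < col d →
    ∃ λ d′ → Meet (endpoints d′) (endpoints d) × col d′ ≡ y × lexLevel block col K d′ < lexLevel block col K d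
  full-star-supplies block col col<K x starwise star∈ d x∈d col≤deg blocks y 1≤y y<c =
    let (s , cs≡y) = injective-colours-exhaust starwise star∈ y (1≤y , ℕ.≤-trans (ℕ.<⇒≤ y<c) col≤deg)
    in star x s , common⇒meet (star-incident x s) x∈d , cs≡y ,
       lex-<ʳ (blocks s) (subst (_< col d) (sym cs≡y) y<c)

-- The 5-cycle

C₅-adjacent : Fin 5 → Fin 5 → Bool
C₅-adjacent a b = (toℕ b ≡ᵇ suc (toℕ a) % 5) ∨ (toℕ a ≡ᵇ suc (toℕ b) % 5)

C₅-adjacent-sym : ∀ a b → T (C₅-adjacent a b) → T (C₅-adjacent b a)
C₅-adjacent-sym a b = subst T (∨-comm (toℕ b ≡ᵇ suc (toℕ a) % 5) _)

C₅-triangle-free : ∀ a b c → ¬ (T (C₅-adjacent a b) × T (C₅-adjacent b c) × T (C₅-adjacent a c))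
C₅-triangle-free = toWitness {a? = all? λ a → all? λ b → all? λ c →
  ¬? (T? (C₅-adjacent a b) ×-dec T? (C₅-adjacent b c) ×-dec T? (C₅-adjacent a c))} _

C₅-labelling⇒triangle-free : ∀ {G : Graph} (label : V G → Fin 5) →
  (∀ e → T (C₅-adjacent (label (proj₁ (ends G e))) (label (proj₂ (ends G e))))) → TriangleFree G
C₅-labelling⇒triangle-free {G} label edges x y z x~y y~z x~z =
  C₅-triangle-free (label x) (label y) (label z) (labels x~y , labels y~z , labels x~z)
  where
  labels : ∀ {a b} → Adj G a b → T (C₅-adjacent (label a) (label b))
  labels (e , inj₁ ends≡) = subst (λ ab → T (C₅-adjacent (label (proj₁ ab)) (label (proj₂ ab)))) ends≡ (edges e)
  labels {a} {b} (e , inj₂ ends≡) = C₅-adjacent-sym (label b) (label a)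
    (subst (λ ab → T (C₅-adjacent (label (proj₁ ab)) (label (proj₂ ab)))) ends≡ (edges e))

module Gadget (n : ℕ) where

  data Edge₁ : Set where
    pp′ qq′ : Edge₁
    p′P q′Q : Fin n → Edge₁
    PQ : Fin n → Fin n → Edge₁

  endpoints₁ : Edge₁ → V₁ n × V₁ n
  endpoints₁ pp′ = p , p′
  endpoints₁ qq′ = q , q′
  endpoints₁ (p′P i) = p′ , P i
  endpoints₁ (q′Q j) = q′ , Q j
  endpoints₁ (PQ i j) = P i , Q j

  Meets₁ : Edge₁ → Edge₁ → Set
  Meets₁ d d′ = Meet (endpoints₁ d) (endpoints₁ d′)

  endpoints₁-injective : Injective _≡_ _≡_ endpoints₁
  endpoints₁-injective {d} {d′} eq =
    just-injective (trans (sym (decode-ends d)) (trans (cong decode eq) (decode-ends d′)))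
    where
    decode : V₁ n × V₁ n → Maybe Edge₁
    decode (p , p′) = just pp′
    decode (q , q′) = just qq′
    decode (p′ , P i) = just (p′P i)
    decode (q′ , Q j) = just (q′Q j)
    decode (P i , Q j) = just (PQ i j)
    decode _ = nothing

    decode-ends : ∀ d → decode (endpoints₁ d) ≡ just d
    decode-ends pp′ = refl
    decode-ends qq′ = refl
    decode-ends (p′P i) = refl
    decode-ends (q′Q j) = refl
    decode-ends (PQ i j) = refl

  private
    row : Fin n → List (V₁ n × V₁ n)
    row i = map (λ j → (P i , Q j)) (allFin n)

    spokes-p′ spokes-q′ middle : List (V₁ n × V₁ n)
    spokes-p′ = map (λ i → (p′ , P i)) (allFin n)
    spokes-q′ = map (λ j → (q′ , Q j)) (allFin n)
    middle = concatMap row (allFin n)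

    ∈-middle⁻ : ∀ {x} → x ∈ middle → ∃₂ λ i j → x ≡ (P i , Q j)
    ∈-middle⁻ x∈ = let (i , x∈row) = satisfied (∈-concatMap⁻ row {xs = allFin n} x∈)
                       (j , _ , x≡) = ∈-map⁻ _ x∈row
                   in i , j , x≡

    data Outer : V₁ n × V₁ n → Set where
      spoke-q′ : ∀ j → Outer (q′ , Q j)
      rung : ∀ i j → Outer (P i , Q j)

    data Inner : V₁ n × V₁ n → Set where
      spoke-p′ : ∀ i → Inner (p′ , P i)
      outer : ∀ {x} → Outer x → Inner x

    ∈-outer⁻ : ∀ {x} → x ∈ spokes-q′ ++ middle → Outer x
    ∈-outer⁻ x∈ with ∈-++⁻ spokes-q′ x∈
    ... | inj₁ x∈q′ with ∈-map⁻ _ x∈q′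
    ...   | j , _ , refl = spoke-q′ j
    ∈-outer⁻ x∈ | inj₂ x∈m with ∈-middle⁻ x∈m
    ...   | i , j , refl = rung i j

    ∈-inner⁻ : ∀ {x} → x ∈ spokes-p′ ++ spokes-q′ ++ middle → Inner x
    ∈-inner⁻ x∈ with ∈-++⁻ spokes-p′ x∈
    ... | inj₁ x∈p′ with ∈-map⁻ _ x∈p′
    ...   | i , _ , refl = spoke-p′ i
    ∈-inner⁻ x∈ | inj₂ x∈′ = outer (∈-outer⁻ x∈′)

    inner-not-p : ∀ {x} → Inner x → proj₁ x ≢ p
    inner-not-p (spoke-p′ i) ()
    inner-not-p (outer (spoke-q′ j)) ()
    inner-not-p (outer (rung i j)) ()

    inner-not-q : ∀ {x} → Inner x → proj₁ x ≢ q
    inner-not-q (spoke-p′ i) ()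
    inner-not-q (outer (spoke-q′ j)) ()
    inner-not-q (outer (rung i j)) ()

    row-unique : ∀ i → Unique (row i)
    row-unique i = Unique.map⁺ (λ { refl → refl }) (Unique.allFin⁺ n)

    rows-disjoint : ∀ {i i′} → i ≢ i′ → Disjoint (row i) (row i′)
    rows-disjoint i≢i′ (x∈i , x∈i′) with ∈-map⁻ _ x∈i | ∈-map⁻ _ x∈i′
    ... | _ , _ , refl | _ , _ , refl = i≢i′ refl

    inner-unique : Unique (spokes-p′ ++ spokes-q′ ++ middle)
    inner-unique =
      Unique.++⁺ (Unique.map⁺ (λ { refl → refl }) (Unique.allFin⁺ n))
        (Unique.++⁺ (Unique.map⁺ (λ { refl → refl }) (Unique.allFin⁺ n))
          (Unique.concat⁺ (All.map⁺ (All.universal row-unique (allFin n)))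
                          (AllPairs.map⁺ (AllPairs.tabulate⁺ rows-disjoint)))
          spokes-q′∩middle)
        spokes-p′∩rest
      where
      spokes-q′∩middle : Disjoint spokes-q′ middle
      spokes-q′∩middle (x∈q′ , x∈m) with ∈-map⁻ _ x∈q′ | ∈-middle⁻ x∈m
      ... | _ , _ , refl | _ , _ , ()

      spokes-p′∩rest : Disjoint spokes-p′ (spokes-q′ ++ middle)
      spokes-p′∩rest (x∈p′ , x∈r) with ∈-map⁻ _ x∈p′ | ∈-outer⁻ x∈r
      ... | _ , _ , refl | ()

  E₁-unique : Unique (E₁ n)
  E₁-unique =
    All.tabulate (λ { (here refl) () ; (there x∈) eq → inner-not-p (∈-inner⁻ x∈) (cong proj₁ (sym eq)) })
    ∷ All.tabulate (λ x∈ eq → inner-not-q (∈-inner⁻ x∈) (cong proj₁ (sym eq)))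
    ∷ inner-unique

  E₁-listed : ∀ d → endpoints₁ d ∈ E₁ n
  E₁-listed pp′ = here refl
  E₁-listed qq′ = there (here refl)
  E₁-listed (p′P i) = there (there (∈-++⁺ˡ (∈-map⁺ _ (∈-allFin i))))
  E₁-listed (q′Q j) = there (there (∈-++⁺ʳ spokes-p′ (∈-++⁺ˡ (∈-map⁺ _ (∈-allFin j)))))
  E₁-listed (PQ i j) = there (there (∈-++⁺ʳ spokes-p′ (∈-++⁺ʳ spokes-q′
    (∈-concatMap⁺ row {xs = allFin n} (Any.map (λ { refl → ∈-map⁺ _ (∈-allFin j) }) (∈-allFin i))))))

  E₁-classify : ∀ {x} → x ∈ E₁ n → ∃ λ d → endpoints₁ d ≡ x
  E₁-classify (here refl) = pp′ , refl
  E₁-classify (there (here refl)) = qq′ , refl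
  E₁-classify (there (there x∈)) with ∈-inner⁻ x∈
  ... | spoke-p′ i = p′P i , refl
  ... | outer (spoke-q′ j) = q′Q j , refl
  ... | outer (rung i j) = PQ i j , refl

  coding₁ : EdgeCoding (G′ₖpq (suc n))
  coding₁ = codingFromList endpoints₁ endpoints₁-injective E₁-unique E₁-listed E₁-classify

  degree₁ : V₁ n → ℕ
  degree₁ p = 1
  degree₁ q = 1
  degree₁ _ = suc n

  star₁ : (x : V₁ n) → Fin (degree₁ x) → Edge₁
  star₁ p _ = pp′
  star₁ q _ = qq′
  star₁ p′ Fin.zero = pp′
  star₁ p′ (Fin.suc i) = p′P i
  star₁ q′ Fin.zero = qq′
  star₁ q′ (Fin.suc j) = q′Q j
  star₁ (P i) Fin.zero = p′P i
  star₁ (P i) (Fin.suc j) = PQ i j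
  star₁ (Q j) Fin.zero = q′Q j
  star₁ (Q j) (Fin.suc i) = PQ i j

  stars₁ : Stars endpoints₁
  stars₁ = record
    { degree = degree₁ ; star = star₁ ; star-incident = star-incident ; incident⇒star = incident⇒star }
    where
    star-incident : ∀ x s → Incident x (endpoints₁ (star₁ x s))
    star-incident p Fin.zero = inj₁ refl
    star-incident q Fin.zero = inj₁ refl
    star-incident p′ Fin.zero = inj₂ refl
    star-incident p′ (Fin.suc i) = inj₁ refl
    star-incident q′ Fin.zero = inj₂ refl
    star-incident q′ (Fin.suc j) = inj₁ refl
    star-incident (P i) Fin.zero = inj₂ refl
    star-incident (P i) (Fin.suc j) = inj₁ refl
    star-incident (Q j) Fin.zero = inj₂ refl
    star-incident (Q j) (Fin.suc i) = inj₂ refl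

    incident⇒star : ∀ x d → Incident x (endpoints₁ d) → ∃ λ s → star₁ x s ≡ d
    incident⇒star _ pp′ (inj₁ refl) = Fin.zero , refl
    incident⇒star _ pp′ (inj₂ refl) = Fin.zero , refl
    incident⇒star _ qq′ (inj₁ refl) = Fin.zero , refl
    incident⇒star _ qq′ (inj₂ refl) = Fin.zero , refl
    incident⇒star _ (p′P i) (inj₁ refl) = Fin.suc i , refl
    incident⇒star _ (p′P i) (inj₂ refl) = Fin.zero , refl
    incident⇒star _ (q′Q j) (inj₁ refl) = Fin.suc j , refl
    incident⇒star _ (q′Q j) (inj₂ refl) = Fin.zero , refl
    incident⇒star _ (PQ i j) (inj₁ refl) = Fin.suc j , refl
    incident⇒star _ (PQ i j) (inj₂ refl) = Fin.suc i , refl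

  open Stars stars₁ using (separating-if-starwise-injective; starwise-injective; full-star-supplies)

  degree₁≤ : ∀ x → degree₁ x ≤ suc n
  degree₁≤ p = s≤s z≤n
  degree₁≤ q = s≤s z≤n
  degree₁≤ p′ = ≤-refl
  degree₁≤ q′ = ≤-refl
  degree₁≤ (P _) = ≤-refl
  degree₁≤ (Q _) = ≤-refl

  -- Colours are hues mod k, and the hues around every vertex are consecutive.
  hue₁ : ℕ → Edge₁ → ℕ
  hue₁ g pp′ = g
  hue₁ g qq′ = g
  hue₁ g (p′P i) = suc (toℕ i) + g
  hue₁ g (q′Q j) = suc (toℕ j) + g
  hue₁ g (PQ i j) = suc (toℕ j) + (suc (toℕ i) + g)

  base₁ : ℕ → V₁ n → ℕ
  base₁ g (P i) = suc (toℕ i) + g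
  base₁ g (Q j) = suc (toℕ j) + g
  base₁ g _ = g

  hue₁-star : ∀ g x s → hue₁ g (star₁ x s) ≡ toℕ s + base₁ g x
  hue₁-star g p Fin.zero = refl
  hue₁-star g q Fin.zero = refl
  hue₁-star g p′ Fin.zero = refl
  hue₁-star g p′ (Fin.suc i) = refl
  hue₁-star g q′ Fin.zero = refl
  hue₁-star g q′ (Fin.suc j) = refl
  hue₁-star g (P i) Fin.zero = refl
  hue₁-star g (P i) (Fin.suc j) = refl
  hue₁-star g (Q j) Fin.zero = refl
  hue₁-star g (Q j) (Fin.suc i) = x∙yz≈y∙xz (suc (toℕ j)) (suc (toℕ i)) g

  colour₁ : ℕ → Edge₁ → ℕ
  colour₁ g d = colourMod (suc n) (hue₁ g d)

  colour₁-starwise-injective : ∀ g x → Injective _≡_ _≡_ (colour₁ g ∘ star₁ x)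
  colour₁-starwise-injective g x {s} {s′} same = toℕ-injective (colourMod-injective (suc n) (base₁ g x)
    (<-≤-trans (toℕ<n s) (degree₁≤ x)) (<-≤-trans (toℕ<n s′) (degree₁≤ x))
    (trans (cong (colourMod (suc n)) (sym (hue₁-star g x s)))
           (trans same (cong (colourMod (suc n)) (hue₁-star g x s′)))))

  star₁-injective : ∀ x → Injective _≡_ _≡_ (star₁ x)
  star₁-injective x eq = colour₁-starwise-injective 0 x (cong (colour₁ 0) eq)

  colour₁-separating : ∀ g d d′ → Meets₁ d d′ → colour₁ g d ≡ colour₁ g d′ → d ≡ d′
  colour₁-separating g = separating-if-starwise-injective (colour₁-starwise-injective g)

  poles-same-colour : ∀ {col} → ProperOn endpoints₁ (suc n) col → col pp′ ≡ col qq′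
  poles-same-colour {col} proper =
    decidable-stable (col pp′ ≟ col qq′) λ differ → q′-spoke-clash (at-q′ differ)
    where
    at : ∀ x → Injective _≡_ _≡_ (col ∘ star₁ x)
    at = starwise-injective star₁-injective proper

    at-P : ∀ i → ∃ λ j → col (PQ i j) ≡ col pp′
    at-P i with injective-colours-exhaust (at (P i)) (proj₁ proper ∘ star₁ (P i)) (col pp′) (proj₁ proper pp′)
    ... | Fin.zero , p′Pi-coloured = contradiction (at p′ {Fin.suc i} {Fin.zero} p′Pi-coloured) λ ()
    ... | Fin.suc j , PQij-coloured = j , PQij-coloured

    partner : Fin n → Fin n
    partner i = proj₁ (at-P i)

    partner-coloured : ∀ i → col (PQ i (partner i)) ≡ col pp′
    partner-coloured i = proj₂ (at-P i)

    partner-injective : Injective _≡_ _≡_ partner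
    partner-injective {i} {i′} eq = Fin.suc-injective (at (Q (partner i′)) {Fin.suc i} {Fin.suc i′}
      (trans (subst (λ j → col (PQ i j) ≡ col pp′) eq (partner-coloured i)) (sym (partner-coloured i′))))

    at-q′ : col pp′ ≢ col qq′ → ∃ λ j → col (q′Q j) ≡ col pp′
    at-q′ differ with injective-colours-exhaust (at q′) (proj₁ proper ∘ star₁ q′) (col pp′) (proj₁ proper pp′)
    ... | Fin.zero , qq′-coloured = contradiction (sym qq′-coloured) differ
    ... | Fin.suc j , q′Qj-coloured = j , q′Qj-coloured

    q′-spoke-clash : (∃ λ j → col (q′Q j) ≡ col pp′) → ⊥
    q′-spoke-clash (j₀ , j₀-coloured) with injective⇒surjective partner-injective j₀
    ... | i , refl =
      0≢1+n (at (Q (partner i)) {Fin.zero} {Fin.suc i} (trans j₀-coloured (sym (partner-coloured i))))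

  block₁ : Edge₁ → ℕ
  block₁ pp′ = 0
  block₁ (p′P _) = 1
  block₁ (PQ _ _) = 2
  block₁ (q′Q _) = 3
  block₁ qq′ = 4

  block₁-positive : ∀ d → d ≢ pp′ → 0 < block₁ d
  block₁-positive pp′ d≢pp′ = contradiction refl d≢pp′
  block₁-positive qq′ _ = s≤s z≤n
  block₁-positive (p′P _) _ = s≤s z≤n
  block₁-positive (PQ _ _) _ = s≤s z≤n
  block₁-positive (q′Q _) _ = s≤s z≤n

  level₁ : ℕ → Edge₁ → ℕ
  level₁ g = lexLevel block₁ (colour₁ g) (suc (suc n))

  colour₁≤ : ∀ g d → colour₁ g d ≤ suc n
  colour₁≤ g d = proj₂ (colourMod-bounds (suc n) (hue₁ g d))

  level₁-block : ∀ g d′ d → block₁ d′ < block₁ d → level₁ g d′ < level₁ g d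
  level₁-block g d′ d = lex-<ˡ (s≤s (colour₁≤ g d′))

  -- The argument of type Fin n names a vertex of Q, where qq′ finds an earlier neighbour.
  grounded₁ : Fin n → ∀ g d → d ≢ pp′ → ∃ λ d′ → Meets₁ d′ d × level₁ g d′ < level₁ g d
  grounded₁ j g pp′ d≢pp′ = contradiction refl d≢pp′
  grounded₁ j g qq′ _ = q′Q j , inj₂ (inj₁ refl) , level₁-block g (q′Q j) qq′ (n<1+n 3)
  grounded₁ j g (p′P i) _ = pp′ , inj₂ (inj₂ (inj₁ refl)) , level₁-block g pp′ (p′P i) (n<1+n 0)
  grounded₁ j g (PQ i j′) _ = p′P i , inj₂ (inj₂ (inj₁ refl)) , level₁-block g (p′P i) (PQ i j′) (n<1+n 1)
  grounded₁ j g (q′Q j′) _ = PQ j′ j′ , inj₂ (inj₂ (inj₂ refl)) , level₁-block g (PQ j′ j′) (q′Q j′) (n<1+n 2)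

  supported-at : ∀ g x → (∀ d → colour₁ g d ≤ degree₁ x) → ∀ d → Incident x (endpoints₁ d) →
                 (∀ s → block₁ (star₁ x s) ≤ block₁ d) → ∀ y → 1 ≤ y → y < colour₁ g d →
                 ∃ λ d′ → Meets₁ d′ d × colour₁ g d′ ≡ y × level₁ g d′ < level₁ g d
  supported-at g x bounded d x∈d = full-star-supplies block₁ (colour₁ g) (s≤s ∘ colour₁≤ g) x
    (colour₁-starwise-injective g x) (λ s → s≤s z≤n , bounded (star₁ x s)) d x∈d (bounded d)

  supported₁ : ∀ g d → d ≢ pp′ → ∀ y → 1 ≤ y → y < colour₁ g d →
               ∃ λ d′ → Meets₁ d′ d × colour₁ g d′ ≡ y × level₁ g d′ < level₁ g d
  supported₁ g pp′ d≢pp′ = contradiction refl d≢pp′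
  supported₁ g qq′ _ = supported-at g q′ (colour₁≤ g) qq′ (inj₂ refl)
    λ { Fin.zero → ≤-refl ; (Fin.suc _) → n≤1+n 3 }
  supported₁ g (p′P i) _ = supported-at g p′ (colour₁≤ g) (p′P i) (inj₁ refl)
    λ { Fin.zero → z≤n ; (Fin.suc _) → ≤-refl }
  supported₁ g (PQ i j) _ = supported-at g (P i) (colour₁≤ g) (PQ i j) (inj₁ refl)
    λ { Fin.zero → n≤1+n 1 ; (Fin.suc _) → ≤-refl }
  supported₁ g (q′Q j) _ = supported-at g (Q j) (colour₁≤ g) (q′Q j) (inj₂ refl)
    λ { Fin.zero → ≤-refl ; (Fin.suc _) → n≤1+n 2 }

  gadget-certificate : Fin n → ∀ {g} → g < suc n → GreedyCertificate Meets₁ pp′ (suc g) (colour₁ g)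
  gadget-certificate j {g} g<k = record
    { level = level₁ g
    ; first-colour = colourMod-small g<k
    ; positive = λ _ _ → s≤s z≤n
    ; separating = colour₁-separating g
    ; first-lowest = first-lowest
    ; grounded = grounded₁ j g
    ; supported = supported₁ g
    }
    where
    first-lowest : ∀ d → d ≢ pp′ → level₁ g pp′ < level₁ g d
    first-lowest d d≢pp′ = level₁-block g pp′ d (block₁-positive d d≢pp′)

  open EdgeCoding coding₁ using (index; edge; ends-index; index-by-ends; proper-restrict; certificate-extend)

  pp′-qq′-same-colour : (c : EdgeColoring (G′ₖpq (suc n))) → ProperEdgeColoring (G′ₖpq (suc n)) (suc n) c →
    ∀ i j → ends (G′ₖpq (suc n)) i ≡ (p , p′) → ends (G′ₖpq (suc n)) j ≡ (q , q′) → c i ≡ c j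
  pp′-qq′-same-colour c proper i j i-ends j-ends = begin
    c i           ≡⟨ cong c (index-by-ends {d = pp′} i-ends) ⟩
    c (index pp′) ≡⟨ poles-same-colour (proper-restrict proper) ⟩
    c (index qq′) ≡⟨ cong c (sym (index-by-ends {d = qq′} j-ends)) ⟩
    c j           ∎
    where open ≡-Reasoning

  greedy-from-pp′ : Fin n → ∀ α → 1 ≤ α → α ≤ suc n →
    ∃[ i ] (ends (G′ₖpq (suc n)) i ≡ (p , p′) × ∃[ c ] IsConnectedGreedy (G′ₖpq (suc n)) i α c)
  greedy-from-pp′ j (suc g) _ g<k =
    index pp′ , ends-index pp′ , colour₁ g ∘ edge ,
    certificate⇒connectedGreedy (certificate-extend (gadget-certificate j g<k))

module Gk (m : ℕ) where

  k : ℕ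
  k = 7 + m

  open Gadget (k ∸ 1)

  data Edge₂ : Set where
    wt : Edge₂
    copy : Fin k → Edge₁ → Edge₂

  embed : Fin k → V₁ (k ∸ 1) × V₁ (k ∸ 1) → V₂ k × V₂ k
  embed c xy = emb c (proj₁ xy) , emb c (proj₂ xy)

  endpoints₂ : Edge₂ → V₂ k × V₂ k
  endpoints₂ wt = w , t
  endpoints₂ (copy c d) = embed c (endpoints₁ d)

  Meets₂ : Edge₂ → Edge₂ → Set
  Meets₂ d d′ = Meet (endpoints₂ d) (endpoints₂ d′)

  private
    unemb : Fin k → V₂ k → V₁ (k ∸ 1)
    unemb _ (cP _ i) = P i
    unemb _ (cQ _ j) = Q j
    unemb _ (cp′ _) = p′
    unemb _ (cq′ _) = q′
    unemb _ u = q
    unemb Fin.zero v = p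
    unemb (Fin.suc _) v = q
    unemb _ w = p
    unemb _ t = p

    unemb-emb : ∀ c x → unemb c (emb c x) ≡ x
    unemb-emb c (P i) = refl
    unemb-emb c (Q j) = refl
    unemb-emb c p′ = refl
    unemb-emb c q′ = refl
    unemb-emb Fin.zero p = refl
    unemb-emb (Fin.suc _) p = refl
    unemb-emb Fin.zero q = refl
    unemb-emb (Fin.suc Fin.zero) q = refl
    unemb-emb (Fin.suc (Fin.suc Fin.zero)) q = refl
    unemb-emb (Fin.suc (Fin.suc (Fin.suc Fin.zero))) q = refl
    unemb-emb (Fin.suc (Fin.suc (Fin.suc (Fin.suc _)))) q = refl

  emb-injective : ∀ c → Injective _≡_ _≡_ (emb c)
  emb-injective c {x} {y} eq = trans (sym (unemb-emb c x)) (trans (cong (unemb c) eq) (unemb-emb c y))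

  embed-injective : ∀ c → Injective _≡_ _≡_ (embed c)
  embed-injective c eq = cong₂ _,_ (emb-injective c (cong proj₁ eq)) (emb-injective c (cong proj₂ eq))

  -- The second endpoint of a gadget edge is never a shared vertex, so it tells the copy.
  copy-of : V₂ k → Maybe (Fin k)
  copy-of (cP c _) = just c
  copy-of (cQ c _) = just c
  copy-of (cp′ c) = just c
  copy-of (cq′ c) = just c
  copy-of _ = nothing

  copy-of-second : ∀ c d → copy-of (proj₂ (endpoints₂ (copy c d))) ≡ just c
  copy-of-second c pp′ = refl
  copy-of-second c qq′ = refl
  copy-of-second c (p′P i) = refl
  copy-of-second c (q′Q j) = refl
  copy-of-second c (PQ i j) = refl

  same-copy : ∀ {c c′ d d′} → proj₂ (endpoints₂ (copy c d)) ≡ proj₂ (endpoints₂ (copy c′ d′)) → c ≡ c′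
  same-copy {c} {c′} {d} {d′} eq =
    just-injective (trans (sym (copy-of-second c d)) (trans (cong copy-of eq) (copy-of-second c′ d′)))

  endpoints₂-injective : Injective _≡_ _≡_ endpoints₂
  endpoints₂-injective {wt} {wt} _ = refl
  endpoints₂-injective {wt} {copy c d} eq =
    contradiction (trans (cong (copy-of ∘ proj₂) eq) (copy-of-second c d)) λ ()
  endpoints₂-injective {copy c d} {wt} eq =
    contradiction (trans (cong (copy-of ∘ proj₂) (sym eq)) (copy-of-second c d)) λ ()
  endpoints₂-injective {copy c d} {copy c′ d′} eq with same-copy {d = d} {d′ = d′} (cong proj₂ eq)
  ... | refl = cong (copy c) (endpoints₁-injective (embed-injective c eq))

  private
    block : Fin k → List (V₂ k × V₂ k)
    block c = map (embed c) (E₁ (k ∸ 1))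

    ∈-block⁻ : ∀ {c x} → x ∈ block c → ∃ λ d → endpoints₂ (copy c d) ≡ x
    ∈-block⁻ {c} x∈ = let (y , y∈ , x≡) = ∈-map⁻ (embed c) x∈
                          (d , ends≡y) = E₁-classify y∈
                      in d , trans (cong (embed c) ends≡y) (sym x≡)

    ∈-blocks⁻ : ∀ {x} → x ∈ concatMap block (allFin k) → ∃₂ λ c d → endpoints₂ (copy c d) ≡ x
    ∈-blocks⁻ x∈ = let (c , x∈c) = satisfied (∈-concatMap⁻ block {xs = allFin k} x∈) in c , ∈-block⁻ x∈c

    blocks-disjoint : ∀ {c c′} → c ≢ c′ → Disjoint (block c) (block c′)
    blocks-disjoint c≢c′ (x∈c , x∈c′) =
      let (d , ends≡) = ∈-block⁻ x∈c
          (d′ , ends≡′) = ∈-block⁻ x∈c′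
      in c≢c′ (copy-injective (endpoints₂-injective {copy _ d} {copy _ d′} (trans ends≡ (sym ends≡′))))
      where
      copy-injective : ∀ {c c′ d d′} → copy c d ≡ copy c′ d′ → c ≡ c′
      copy-injective refl = refl

  E₂-unique : Unique (E₂ k)
  E₂-unique =
    All.tabulate (λ x∈ wt-ends →
      let (c , d , ends≡) = ∈-blocks⁻ x∈
      in contradiction (endpoints₂-injective {wt} {copy c d} (trans wt-ends (sym ends≡))) λ ())
    ∷ Unique.concat⁺ (All.map⁺ (All.universal (λ c → Unique.map⁺ (embed-injective c) E₁-unique) (allFin k)))
                     (AllPairs.map⁺ (AllPairs.tabulate⁺ blocks-disjoint))

  E₂-listed : ∀ d → endpoints₂ d ∈ E₂ k
  E₂-listed wt = here refl
  E₂-listed (copy c d) = there (∈-concatMap⁺ block {xs = allFin k}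
    (Any.map (λ { refl → ∈-map⁺ (embed c) (E₁-listed d) }) (∈-allFin c)))

  E₂-classify : ∀ {x} → x ∈ E₂ k → ∃ λ d → endpoints₂ d ≡ x
  E₂-classify (here refl) = wt , refl
  E₂-classify (there x∈) = let (c , d , ends≡) = ∈-blocks⁻ x∈ in copy c d , ends≡

  coding₂ : EdgeCoding (G′ₖ k)
  coding₂ = codingFromList endpoints₂ endpoints₂-injective E₂-unique E₂-listed E₂-classify

  degree₂ : V₂ k → ℕ
  degree₂ u = 4
  degree₂ v = k ∸ 3
  degree₂ t = 1
  degree₂ _ = k

  star₂ : (x : V₂ k) → Fin (degree₂ x) → Edge₂
  star₂ (cP c i) s = copy c (star₁ (P i) s)
  star₂ (cQ c j) s = copy c (star₁ (Q j) s)
  star₂ (cp′ c) s = copy c (star₁ p′ s)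
  star₂ (cq′ c) s = copy c (star₁ q′ s)
  star₂ u Fin.zero = copy Fin.zero qq′
  star₂ u (Fin.suc Fin.zero) = copy (Fin.suc Fin.zero) qq′
  star₂ u (Fin.suc (Fin.suc Fin.zero)) = copy (Fin.suc (Fin.suc Fin.zero)) qq′
  star₂ u (Fin.suc (Fin.suc (Fin.suc Fin.zero))) = copy (Fin.suc (Fin.suc (Fin.suc Fin.zero))) qq′
  star₂ v Fin.zero = copy Fin.zero pp′
  star₂ v (Fin.suc s) = copy (Fin.suc (Fin.suc (Fin.suc (Fin.suc s)))) qq′
  star₂ w Fin.zero = wt
  star₂ w (Fin.suc c) = copy (Fin.suc c) pp′
  star₂ t Fin.zero = wt

  incident-embed : ∀ c {y} d → Incident y (endpoints₁ d) → Incident (emb c y) (endpoints₂ (copy c d))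
  incident-embed c _ (inj₁ eq) = inj₁ (cong (emb c) eq)
  incident-embed c _ (inj₂ eq) = inj₂ (cong (emb c) eq)

  meets-embed : ∀ c d d′ → Meets₁ d d′ → Meets₂ (copy c d) (copy c d′)
  meets-embed c d d′ d~d′ =
    let (y , y∈d , y∈d′) = meet⇒common d~d′ in common⇒meet (incident-embed c d y∈d) (incident-embed c d′ y∈d′)

  stars₂ : Stars endpoints₂
  stars₂ = record
    { degree = degree₂ ; star = star₂ ; star-incident = star-incident ; incident⇒star = incident⇒star }
    where
    open Stars stars₁ using () renaming (star-incident to star₁-incident)

    star-incident : ∀ x s → Incident x (endpoints₂ (star₂ x s))
    star-incident (cP c i) s = incident-embed c (star₁ (P i) s) (star₁-incident (P i) s)
    star-incident (cQ c j) s = incident-embed c (star₁ (Q j) s) (star₁-incident (Q j) s)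
    star-incident (cp′ c) s = incident-embed c (star₁ p′ s) (star₁-incident p′ s)
    star-incident (cq′ c) s = incident-embed c (star₁ q′ s) (star₁-incident q′ s)
    star-incident u Fin.zero = inj₁ refl
    star-incident u (Fin.suc Fin.zero) = inj₁ refl
    star-incident u (Fin.suc (Fin.suc Fin.zero)) = inj₁ refl
    star-incident u (Fin.suc (Fin.suc (Fin.suc Fin.zero))) = inj₁ refl
    star-incident v Fin.zero = inj₁ refl
    star-incident v (Fin.suc s) = inj₁ refl
    star-incident w Fin.zero = inj₁ refl
    star-incident w (Fin.suc s) = inj₁ refl
    star-incident t Fin.zero = inj₂ refl

    incident⇒star : ∀ x d → Incident x (endpoints₂ d) → ∃ λ s → star₂ x s ≡ d
    incident⇒star _ wt (inj₁ refl) = Fin.zero , refl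
    incident⇒star _ wt (inj₂ refl) = Fin.zero , refl
    incident⇒star _ (copy Fin.zero pp′) (inj₁ refl) = Fin.zero , refl
    incident⇒star _ (copy (Fin.suc c) pp′) (inj₁ refl) = Fin.suc c , refl
    incident⇒star _ (copy Fin.zero qq′) (inj₁ refl) = Fin.zero , refl
    incident⇒star _ (copy (Fin.suc Fin.zero) qq′) (inj₁ refl) = Fin.suc Fin.zero , refl
    incident⇒star _ (copy (Fin.suc (Fin.suc Fin.zero)) qq′) (inj₁ refl) = Fin.suc (Fin.suc Fin.zero) , refl
    incident⇒star _ (copy (Fin.suc (Fin.suc (Fin.suc Fin.zero))) qq′) (inj₁ refl) =
      Fin.suc (Fin.suc (Fin.suc Fin.zero)) , refl
    incident⇒star _ (copy (Fin.suc (Fin.suc (Fin.suc (Fin.suc c)))) qq′) (inj₁ refl) = Fin.suc c , refl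
    incident⇒star _ (copy c (p′P i)) (inj₁ refl) = Fin.suc i , refl
    incident⇒star _ (copy c (q′Q j)) (inj₁ refl) = Fin.suc j , refl
    incident⇒star _ (copy c (PQ i j)) (inj₁ refl) = Fin.suc j , refl
    incident⇒star _ (copy c pp′) (inj₂ refl) = Fin.zero , refl
    incident⇒star _ (copy c qq′) (inj₂ refl) = Fin.zero , refl
    incident⇒star _ (copy c (p′P i)) (inj₂ refl) = Fin.zero , refl
    incident⇒star _ (copy c (q′Q j)) (inj₂ refl) = Fin.zero , refl
    incident⇒star _ (copy c (PQ i j)) (inj₂ refl) = Fin.suc i , refl

  open Stars stars₂
    using (incident⇒star; separating-if-starwise-injective; starwise-injective; degree≤colours; full-star-supplies)
  open EdgeCoding coding₂
    using (index; edge; ends-index; ends-edge; edge-by-ends; proper-extend; proper-restrict; certificate-extend;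
           greedy-proper; greedy-first; greedy-entry)

  hue₂ : ℕ → Edge₂ → ℕ
  hue₂ a wt = a
  hue₂ a (copy c d) = hue₁ (toℕ c + a) d

  colour₂ : ℕ → Edge₂ → ℕ
  colour₂ a d = colourMod k (hue₂ a d)

  base₂ : ℕ → V₂ k → ℕ
  base₂ a (cP c i) = base₁ (toℕ c + a) (P i)
  base₂ a (cQ c j) = base₁ (toℕ c + a) (Q j)
  base₂ a (cp′ c) = base₁ (toℕ c + a) p′
  base₂ a (cq′ c) = base₁ (toℕ c + a) q′
  base₂ a _ = a

  offset₂ : (x : V₂ k) → Fin (degree₂ x) → ℕ
  offset₂ v Fin.zero = 0
  offset₂ v (Fin.suc s) = 4 + toℕ s
  offset₂ _ s = toℕ s

  hue₂-star : ∀ a x s → hue₂ a (star₂ x s) ≡ offset₂ x s + base₂ a x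
  hue₂-star a (cP c i) s = hue₁-star (toℕ c + a) (P i) s
  hue₂-star a (cQ c j) s = hue₁-star (toℕ c + a) (Q j) s
  hue₂-star a (cp′ c) s = hue₁-star (toℕ c + a) p′ s
  hue₂-star a (cq′ c) s = hue₁-star (toℕ c + a) q′ s
  hue₂-star a u Fin.zero = refl
  hue₂-star a u (Fin.suc Fin.zero) = refl
  hue₂-star a u (Fin.suc (Fin.suc Fin.zero)) = refl
  hue₂-star a u (Fin.suc (Fin.suc (Fin.suc Fin.zero))) = refl
  hue₂-star a v Fin.zero = refl
  hue₂-star a v (Fin.suc s) = refl
  hue₂-star a w Fin.zero = refl
  hue₂-star a w (Fin.suc s) = refl
  hue₂-star a t Fin.zero = refl

  offset₂<k : ∀ x s → offset₂ x s < k
  offset₂<k (cP _ _) s = toℕ<n s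
  offset₂<k (cQ _ _) s = toℕ<n s
  offset₂<k (cp′ _) s = toℕ<n s
  offset₂<k (cq′ _) s = toℕ<n s
  offset₂<k u s = <-≤-trans (toℕ<n s) (ℕ.m≤m+n 4 (3 + m))
  offset₂<k v Fin.zero = s≤s z≤n
  offset₂<k v (Fin.suc s) = s≤s (s≤s (s≤s (s≤s (toℕ<n s))))
  offset₂<k w s = toℕ<n s
  offset₂<k t s = <-≤-trans (toℕ<n s) (s≤s z≤n)

  offset₂-injective : ∀ x → Injective _≡_ _≡_ (offset₂ x)
  offset₂-injective (cP _ _) = toℕ-injective
  offset₂-injective (cQ _ _) = toℕ-injective
  offset₂-injective (cp′ _) = toℕ-injective
  offset₂-injective (cq′ _) = toℕ-injective
  offset₂-injective u = toℕ-injective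
  offset₂-injective v {Fin.zero} {Fin.zero} _ = refl
  offset₂-injective v {Fin.suc s} {Fin.suc s′} eq = cong Fin.suc (toℕ-injective (ℕ.+-cancelˡ-≡ 4 _ _ eq))
  offset₂-injective w = toℕ-injective
  offset₂-injective t = toℕ-injective

  colour₂-starwise-injective : ∀ a x → Injective _≡_ _≡_ (colour₂ a ∘ star₂ x)
  colour₂-starwise-injective a x {s} {s′} same = offset₂-injective x (colourMod-injective k (base₂ a x)
    (offset₂<k x s) (offset₂<k x s′)
    (trans (cong (colourMod k) (sym (hue₂-star a x s))) (trans same (cong (colourMod k) (hue₂-star a x s′)))))

  star₂-injective : ∀ x → Injective _≡_ _≡_ (star₂ x)
  star₂-injective x eq = colour₂-starwise-injective 0 x (cong (colour₂ 0) eq)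

  colour₂-separating : ∀ a d d′ → Meets₂ d d′ → colour₂ a d ≡ colour₂ a d′ → d ≡ d′
  colour₂-separating a = separating-if-starwise-injective (colour₂-starwise-injective a)

  colour₂-proper : ∀ a → ProperOn endpoints₂ k (colour₂ a)
  colour₂-proper a = (λ d → colourMod-bounds k (hue₂ a d)) ,
                     λ d d′ d≢d′ d~d′ same → d≢d′ (colour₂-separating a d d′ d~d′ same)

  chromatic-index : ChromaticIndex (G′ₖ k) k
  chromatic-index = (colour₂ 0 ∘ edge , proper-extend (colour₂-proper 0)) ,
                    λ j (c , c-proper) → degree≤colours star₂-injective (proper-restrict c-proper) w

  -- copy 0; copies 1–3, whose q is u; copies 4, …, k − 1, whose q is v
  data Role : Set where
    first early late : Role

  role : Fin k → Role
  role Fin.zero = first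
  role (Fin.suc Fin.zero) = early
  role (Fin.suc (Fin.suc Fin.zero)) = early
  role (Fin.suc (Fin.suc (Fin.suc Fin.zero))) = early
  role (Fin.suc (Fin.suc (Fin.suc (Fin.suc _)))) = late

  walk : Fin 5 → Fin 5 → Fin 5 → Fin 5 → Fin 5 → Fin 5 → V₁ (k ∸ 1) → Fin 5
  walk a _ _ _ _ _ p = a
  walk _ b _ _ _ _ p′ = b
  walk _ _ c _ _ _ (P _) = c
  walk _ _ _ d _ _ (Q _) = d
  walk _ _ _ _ e _ q′ = e
  walk _ _ _ _ _ f q = f

  -- Each copy is mapped onto a walk p p′ P Q q′ q of the 5-cycle, consistently on u, v, w.
  gadget-label : Role → V₁ (k ∸ 1) → Fin 5
  gadget-label first = walk (# 2) (# 1) (# 0) (# 4) (# 0) (# 1)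
  gadget-label early = walk (# 0) (# 1) (# 2) (# 3) (# 2) (# 1)
  gadget-label late = walk (# 0) (# 4) (# 3) (# 2) (# 1) (# 2)

  label : V₂ k → Fin 5
  label (cP c i) = gadget-label (role c) (P i)
  label (cQ c j) = gadget-label (role c) (Q j)
  label (cp′ c) = gadget-label (role c) p′
  label (cq′ c) = gadget-label (role c) q′
  label u = # 1
  label v = # 2
  label w = # 0
  label t = # 1

  C₅-edge : V₂ k × V₂ k → Set
  C₅-edge xy = T (C₅-adjacent (label (proj₁ xy)) (label (proj₂ xy)))

  edges-labelled : ∀ d → C₅-edge (endpoints₂ d)
  edges-labelled wt = _
  edges-labelled (copy Fin.zero pp′) = _
  edges-labelled (copy Fin.zero qq′) = _
  edges-labelled (copy Fin.zero (p′P _)) = _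
  edges-labelled (copy Fin.zero (q′Q _)) = _
  edges-labelled (copy Fin.zero (PQ _ _)) = _
  edges-labelled (copy (Fin.suc Fin.zero) pp′) = _
  edges-labelled (copy (Fin.suc Fin.zero) qq′) = _
  edges-labelled (copy (Fin.suc Fin.zero) (p′P _)) = _
  edges-labelled (copy (Fin.suc Fin.zero) (q′Q _)) = _
  edges-labelled (copy (Fin.suc Fin.zero) (PQ _ _)) = _
  edges-labelled (copy (Fin.suc (Fin.suc Fin.zero)) pp′) = _
  edges-labelled (copy (Fin.suc (Fin.suc Fin.zero)) qq′) = _
  edges-labelled (copy (Fin.suc (Fin.suc Fin.zero)) (p′P _)) = _
  edges-labelled (copy (Fin.suc (Fin.suc Fin.zero)) (q′Q _)) = _
  edges-labelled (copy (Fin.suc (Fin.suc Fin.zero)) (PQ _ _)) = _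
  edges-labelled (copy (Fin.suc (Fin.suc (Fin.suc Fin.zero))) pp′) = _
  edges-labelled (copy (Fin.suc (Fin.suc (Fin.suc Fin.zero))) qq′) = _
  edges-labelled (copy (Fin.suc (Fin.suc (Fin.suc Fin.zero))) (p′P _)) = _
  edges-labelled (copy (Fin.suc (Fin.suc (Fin.suc Fin.zero))) (q′Q _)) = _
  edges-labelled (copy (Fin.suc (Fin.suc (Fin.suc Fin.zero))) (PQ _ _)) = _
  edges-labelled (copy (Fin.suc (Fin.suc (Fin.suc (Fin.suc _)))) pp′) = _
  edges-labelled (copy (Fin.suc (Fin.suc (Fin.suc (Fin.suc _)))) qq′) = _
  edges-labelled (copy (Fin.suc (Fin.suc (Fin.suc (Fin.suc _)))) (p′P _)) = _
  edges-labelled (copy (Fin.suc (Fin.suc (Fin.suc (Fin.suc _)))) (q′Q _)) = _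
  edges-labelled (copy (Fin.suc (Fin.suc (Fin.suc (Fin.suc _)))) (PQ _ _)) = _

  triangle-free : TriangleFree (G′ₖ k)
  triangle-free =
    C₅-labelling⇒triangle-free label λ e → subst C₅-edge (sym (ends-edge e)) (edges-labelled (edge e))

  -- Copy 0 comes after all other copies (whose blocks are 1–5), so its pp′ finds the colours below α at v.
  copy-block : Fin k → ℕ
  copy-block Fin.zero = 6
  copy-block (Fin.suc _) = 1

  block₂ : Edge₂ → ℕ
  block₂ wt = 0
  block₂ (copy c d) = copy-block c + block₁ d

  level₂ : ℕ → Edge₂ → ℕ
  level₂ a = lexLevel block₂ (colour₂ a) (suc k)

  colour₂≤ : ∀ a d → colour₂ a d ≤ k
  colour₂≤ a d = proj₂ (colourMod-bounds k (hue₂ a d))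

  level₂-block : ∀ a e′ e → block₂ e′ < block₂ e → level₂ a e′ < level₂ a e
  level₂-block a e′ e = lex-<ˡ (s≤s (colour₂≤ a e′))

  level₂-copy : ∀ a c d → level₂ a (copy c d) ≡ copy-block c * suc k + level₁ (toℕ c + a) d
  level₂-copy a c d = trans (cong (_+ colour₂ a (copy c d)) (ℕ.*-distribʳ-+ (suc k) (copy-block c) (block₁ d)))
                            (ℕ.+-assoc (copy-block c * suc k) _ _)

  level₂-lift : ∀ a c {d′ d} → level₁ (toℕ c + a) d′ < level₁ (toℕ c + a) d →
                level₂ a (copy c d′) < level₂ a (copy c d)
  level₂-lift a c {d′} {d} lower =
    subst₂ _<_ (sym (level₂-copy a c d′)) (sym (level₂-copy a c d)) (ℕ.+-monoʳ-< (copy-block c * suc k) lower)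

  grounded-in-copy : ∀ a c d → d ≢ pp′ → ∃ λ e → Meets₂ e (copy c d) × level₂ a e < level₂ a (copy c d)
  grounded-in-copy a c d d≢pp′ =
    let (d′ , d′~d , lower) = grounded₁ Fin.zero (toℕ c + a) d d≢pp′
    in copy c d′ , meets-embed c d′ d d′~d , level₂-lift a c lower

  supported-in-copy : ∀ a c d → d ≢ pp′ → ∀ y → 1 ≤ y → y < colour₂ a (copy c d) →
                      ∃ λ e → Meets₂ e (copy c d) × colour₂ a e ≡ y × level₂ a e < level₂ a (copy c d)
  supported-in-copy a c d d≢pp′ y 1≤y y<c =
    let (d′ , d′~d , coloured , lower) = supported₁ (toℕ c + a) d d≢pp′ y 1≤y y<c
    in copy c d′ , meets-embed c d′ d d′~d , coloured , level₂-lift a c lower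

  -- At v the copies 4, …, k − 1 have hues a + 4, …, a + k − 1, which cover the residues 0, …, a − 1.
  v-supplies : ∀ {a} → a ≤ 3 + m → ∀ {y} → y < a →
               ∃ λ s → colour₂ a (star₂ v (Fin.suc s)) ≡ suc y
  v-supplies {a} a≤ {y} y<a = fromℕ< bound , cong suc (begin
    (4 + (toℕ (fromℕ< bound) + a)) % k  ≡⟨ cong (λ s → (4 + (s + a)) % k) (toℕ-fromℕ< bound) ⟩
    (4 + ((r + y) + a)) % k             ≡⟨ cong (λ h → (4 + h) % k) (xy∙z≈xz∙y r y a) ⟩
    (4 + ((r + a) + y)) % k             ≡⟨ cong (λ h → (4 + (h + y)) % k) (ℕ.m∸n+n≡m a≤) ⟩
    (k + y) % k                         ≡⟨ %-remove-+ˡ y (∣-refl {k}) ⟩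
    y % k                               ≡⟨ m<n⇒m%n≡m (<-≤-trans y<a (ℕ.m≤n⇒m≤o+n 4 a≤)) ⟩
    y                                   ∎)
    where
    open ≡-Reasoning
    r : ℕ
    r = 3 + m ∸ a
    bound : r + y < 3 + m
    bound = subst (r + y <_) (ℕ.m∸n+n≡m a≤) (ℕ.+-monoʳ-< r y<a)

  certificate₂ : ∀ {a} → a ≤ 3 + m → GreedyCertificate Meets₂ wt (suc a) (colour₂ a)
  certificate₂ {a} a≤ = record
    { level = level₂ a
    ; first-colour = colourMod-small a<k
    ; positive = λ _ _ → s≤s z≤n
    ; separating = colour₂-separating a
    ; first-lowest = first-lowest
    ; grounded = grounded
    ; supported = supported
    }
    where
    a<k : a < k
    a<k = s≤s (ℕ.m≤n⇒m≤o+n 3 a≤)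

    first-lowest : ∀ e → e ≢ wt → level₂ a wt < level₂ a e
    first-lowest wt e≢wt = contradiction refl e≢wt
    first-lowest (copy Fin.zero d) _ = level₂-block a wt (copy Fin.zero d) (s≤s z≤n)
    first-lowest (copy (Fin.suc c) d) _ = level₂-block a wt (copy (Fin.suc c) d) (s≤s z≤n)

    grounded : ∀ e → e ≢ wt → ∃ λ e′ → Meets₂ e′ e × level₂ a e′ < level₂ a e
    grounded wt e≢wt = contradiction refl e≢wt
    grounded (copy Fin.zero pp′) _ =
      copy (# 4) qq′ , inj₁ refl , level₂-block a (copy (# 4) qq′) (copy Fin.zero pp′) (n<1+n 5)
    grounded (copy (Fin.suc c) pp′) _ = wt , inj₁ refl , level₂-block a wt (copy (Fin.suc c) pp′) (n<1+n 0)
    grounded (copy c qq′) _ = grounded-in-copy a c qq′ λ ()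
    grounded (copy c (p′P i)) _ = grounded-in-copy a c (p′P i) λ ()
    grounded (copy c (q′Q j)) _ = grounded-in-copy a c (q′Q j) λ ()
    grounded (copy c (PQ i j)) _ = grounded-in-copy a c (PQ i j) λ ()

    supported : ∀ e → e ≢ wt → ∀ y → 1 ≤ y → y < colour₂ a e →
                ∃ λ e′ → Meets₂ e′ e × colour₂ a e′ ≡ y × level₂ a e′ < level₂ a e
    supported wt e≢wt = contradiction refl e≢wt
    supported (copy Fin.zero pp′) _ (suc y) _ y<α =
      let (s , coloured) = v-supplies a≤ (ℕ.≤-pred (subst (suc y <_) (colourMod-small a<k) y<α))
      in star₂ v (Fin.suc s) , inj₁ refl , coloured ,
         level₂-block a (star₂ v (Fin.suc s)) (copy Fin.zero pp′) (n<1+n 5)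
    supported (copy (Fin.suc c) pp′) _ =
      full-star-supplies block₂ (colour₂ a) (s≤s ∘ colour₂≤ a) w (colour₂-starwise-injective a w)
        (λ s → colourMod-bounds k (hue₂ a (star₂ w s)))
        (copy (Fin.suc c) pp′) (inj₁ refl) (colour₂≤ a (copy (Fin.suc c) pp′))
        λ { Fin.zero → z≤n ; (Fin.suc _) → ≤-refl }
    supported (copy c qq′) _ = supported-in-copy a c qq′ λ ()
    supported (copy c (p′P i)) _ = supported-in-copy a c (p′P i) λ ()
    supported (copy c (q′Q j)) _ = supported-in-copy a c (q′Q j) λ ()
    supported (copy c (PQ i j)) _ = supported-in-copy a c (PQ i j) λ ()

  bound⇒greedy-from-wt : ∀ α → 1 ≤ α → α ≤ k ∸ 3 →
    ∃[ i ] (ends (G′ₖ k) i ≡ (w , t) × ∃[ c ] (IsConnectedGreedy (G′ₖ k) i α c × (∀ e → c e ≤ k)))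
  bound⇒greedy-from-wt (suc a) _ (s≤s a≤) =
    index wt , ends-index wt , colour₂ a ∘ edge ,
    certificate⇒connectedGreedy (certificate-extend (certificate₂ a≤)) , (λ e → colour₂≤ a (edge e))

  InCopy₀ : Edge₂ → Set
  InCopy₀ e = ∃ λ d → e ≡ copy Fin.zero d

  inCopy₀? : ∀ e → Dec (InCopy₀ e)
  inCopy₀? wt = no λ ()
  inCopy₀? (copy Fin.zero d) = yes (d , refl)
  inCopy₀? (copy (Fin.suc _) _) = no λ ()

  -- Copy 0 touches the rest of G′ₖ only at v, through pp′, and at u, through qq′.
  data Gate : Edge₁ → V₂ k → Set where
    p-gate : Gate pp′ v
    q-gate : Gate qq′ u

  private-incident : ∀ {x c e} → copy-of x ≡ just c → Incident x (endpoints₂ e) → ∃ λ d → e ≡ copy c d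
  private-incident {x} {c} {e} x-private x∈e with incident⇒star x e x∈e
  private-incident {cP _ i} refl _ | s , refl = star₁ (P i) s , refl
  private-incident {cQ _ j} refl _ | s , refl = star₁ (Q j) s , refl
  private-incident {cp′ _} refl _ | s , refl = star₁ p′ s , refl
  private-incident {cq′ _} refl _ | s , refl = star₁ q′ s , refl

  copy₀-incidence : ∀ x d → Incident x (endpoints₂ (copy Fin.zero d)) → copy-of x ≡ just Fin.zero ⊎ Gate d x
  copy₀-incidence _ pp′ (inj₁ refl) = inj₂ p-gate
  copy₀-incidence _ qq′ (inj₁ refl) = inj₂ q-gate
  copy₀-incidence _ (p′P i) (inj₁ refl) = inj₁ refl
  copy₀-incidence _ (q′Q j) (inj₁ refl) = inj₁ refl
  copy₀-incidence _ (PQ i j) (inj₁ refl) = inj₁ refl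
  copy₀-incidence _ d (inj₂ refl) = inj₁ (copy-of-second Fin.zero d)

  copy₀-exit : ∀ d e → ¬ InCopy₀ e → Meets₂ e (copy Fin.zero d) → ∃ λ x → Gate d x × Incident x (endpoints₂ e)
  copy₀-exit d e e-outside e~d with meet⇒common e~d
  ... | x , x∈e , x∈d with copy₀-incidence x d x∈d
  ...   | inj₁ x-private = contradiction (private-incident x-private x∈e) e-outside
  ...   | inj₂ gate = x , gate , x∈e

  exit-through : ∀ {d x} → Gate d x → ∀ e → ¬ InCopy₀ e → Meets₂ e (copy Fin.zero d) → ∃ λ s → star₂ x s ≡ e
  exit-through gate e e-outside e~d =
    let (x′ , gate′ , x′∈e) = copy₀-exit _ e e-outside e~d in same-gate gate′ gate (incident⇒star x′ e x′∈e)
    where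
    same-gate : ∀ {d x x′} → Gate d x′ → Gate d x → (∃ λ s → star₂ x′ s ≡ e) → ∃ λ s → star₂ x s ≡ e
    same-gate p-gate p-gate found = found
    same-gate q-gate q-gate found = found

  gate-in-star : ∀ {d x} → Gate d x → ∃ λ s → star₂ x s ≡ copy Fin.zero d
  gate-in-star p-gate = Fin.zero , refl
  gate-in-star q-gate = Fin.zero , refl

  gate-degree : ∀ {d x} → Gate d x → degree₂ x ≤ k ∸ 3
  gate-degree p-gate = ≤-refl
  gate-degree q-gate = ℕ.m≤m+n 4 m

  copy-restrict : ∀ {col} c → ProperOn endpoints₂ k col → ProperOn endpoints₁ (suc (k ∸ 1)) (col ∘ copy c)
  copy-restrict c (col∈ , col-proper) =
    (col∈ ∘ copy c) , λ d d′ d≢d′ d~d′ → col-proper _ _ (d≢d′ ∘ copy-injective) (meets-embed c d d′ d~d′)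
    where
    copy-injective : ∀ {d d′} → copy c d ≡ copy c d′ → d ≡ d′
    copy-injective refl = refl

  late-pole-meets : ∀ c → ∃ λ d → (d ≡ pp′ ⊎ d ≡ qq′) × Meets₂ (copy (Fin.suc c) qq′) (copy Fin.zero d)
  late-pole-meets Fin.zero = qq′ , inj₂ refl , inj₁ refl
  late-pole-meets (Fin.suc Fin.zero) = qq′ , inj₂ refl , inj₁ refl
  late-pole-meets (Fin.suc (Fin.suc Fin.zero)) = qq′ , inj₂ refl , inj₁ refl
  late-pole-meets (Fin.suc (Fin.suc (Fin.suc _))) = pp′ , inj₁ refl , inj₁ refl

  module _ {col : Edge₂ → ℕ} {α} (proper₂ : ProperOn endpoints₂ k col) (wt-colour : col wt ≡ α) where

    poles : ∀ c → col (copy c pp′) ≡ col (copy c qq′)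
    poles c = poles-same-colour (copy-restrict c proper₂)

    pole-colour : col (copy Fin.zero pp′) ≡ α
    pole-colour = at-w (injective-colours-exhaust (starwise-injective star₂-injective proper₂ w)
                         (proj₁ proper₂ ∘ star₂ w) (col (copy Fin.zero pp′)) (proj₁ proper₂ (copy Fin.zero pp′)))
      where
      same-as-pp′ : ∀ {d} → d ≡ pp′ ⊎ d ≡ qq′ → col (copy Fin.zero pp′) ≡ col (copy Fin.zero d)
      same-as-pp′ (inj₁ refl) = refl
      same-as-pp′ (inj₂ refl) = poles Fin.zero

      at-w : (∃ λ s → col (star₂ w s) ≡ col (copy Fin.zero pp′)) → col (copy Fin.zero pp′) ≡ α
      at-w (Fin.zero , wt-coloured) = trans (sym wt-coloured) wt-colour
      at-w (Fin.suc c , coloured) =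
        let (d , is-pole , meets) = late-pole-meets c
        in contradiction (trans (sym (poles (Fin.suc c))) (trans coloured (same-as-pp′ is-pole)))
                         (proj₂ proper₂ _ _ (λ ()) meets)

    gate-colour : ∀ {d x} → Gate d x → col (copy Fin.zero d) ≡ α
    gate-colour p-gate = pole-colour
    gate-colour q-gate = trans (sym (poles Fin.zero)) pole-colour

    -- The first edge of copy 0 to be coloured is a pole, coloured α, and all smaller colours sit at its gate.
    copy₀-entry-bound : ∀ {d*} → InCopy₀ d* → (∃ λ f → ¬ InCopy₀ f × Meets₂ f d*) →
                        (∀ y → 1 ≤ y → y < col d* → ∃ λ f → ¬ InCopy₀ f × Meets₂ f d* × col f ≡ y) →
                        α ≤ k ∸ 3
    copy₀-entry-bound (d , refl) (f , f-outside , f~d) earlier-colours =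
      let (x , gate , _) = copy₀-exit d f f-outside f~d
      in ℕ.≤-trans (colours-covered⇒≤ (col ∘ star₂ x) (covered gate)) (gate-degree gate)
      where
      covered : ∀ {x} → Gate d x → ∀ y → 1 ≤ y → y ≤ α → ∃ λ s → col (star₂ x s) ≡ y
      covered gate y 1≤y y≤α with ℕ.m≤n⇒m<n∨m≡n y≤α
      ... | inj₂ refl = let (s , at-gate) = gate-in-star gate in s , trans (cong col at-gate) (gate-colour gate)
      ... | inj₁ y<α =
        let (f , f-outside , f~d , cf≡y) = earlier-colours y 1≤y (subst (y <_) (sym (gate-colour gate)) y<α)
            (s , star≡f) = exit-through gate f f-outside f~d
        in s , trans (cong col star≡f) cf≡y

  greedy-from-wt⇒bound : ∀ α → 1 ≤ α →
    (∃[ i ] (ends (G′ₖ k) i ≡ (w , t) × ∃[ c ] (IsConnectedGreedy (G′ₖ k) i α c × (∀ e → c e ≤ k)))) →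
    α ≤ k ∸ 3
  greedy-from-wt⇒bound α 1≤α (i , i-ends , c , greedy , c≤k) =
    let edge-i = edge-by-ends {i} {wt} i-ends
        (d* , d*-in-copy₀ , neighbour , colours) =
          greedy-entry {e₀ = i} {c = c} greedy inCopy₀? (subst (¬_ ∘ InCopy₀) (sym edge-i) λ ()) (pp′ , refl)
    in copy₀-entry-bound (greedy-proper {e₀ = i} {c = c} greedy 1≤α c≤k)
                         (trans (cong (c ∘ index) (sym edge-i)) (greedy-first {e₀ = i} {c = c} greedy))
                         d*-in-copy₀ neighbour colours

lemma8 : (k : ℕ) → 7 ≤ k →
  ((c : EdgeColoring (G′ₖpq k)) → ProperEdgeColoring (G′ₖpq k) k c →
     ∀ i j → ends (G′ₖpq k) i ≡ (p , p′) → ends (G′ₖpq k) j ≡ (q , q′) → c i ≡ c j)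
  ×
  (∀ α → 1 ≤ α → α ≤ k →
     ∃[ i ] (ends (G′ₖpq k) i ≡ (p , p′) × ∃[ c ] IsConnectedGreedy (G′ₖpq k) i α c))
  ×
  TriangleFree (G′ₖ k)
  ×
  ChromaticIndex (G′ₖ k) k
  ×
  (∀ α → 1 ≤ α →
     (∃[ i ] (ends (G′ₖ k) i ≡ (w , t) ×
        ∃[ c ] (IsConnectedGreedy (G′ₖ k) i α c × (∀ e → c e ≤ k))))
     ⇔ (α ≤ k ∸ 3))
lemma8 k 7≤k with m , refl ← m≤n⇒∃[o]m+o≡n 7≤k =
  Gadget.pp′-qq′-same-colour (k ∸ 1) ,
  Gadget.greedy-from-pp′ (k ∸ 1) Fin.zero ,
  triangle-free ,
  chromatic-index ,
  λ α 1≤α → mk⇔ (greedy-from-wt⇒bound α 1≤α) (bound⇒greedy-from-wt α 1≤α)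
  where open Gk m hiding (k)
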